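{- Let $\mathbb{K}$ be a field of characteristic zero, and let $G$ and $G'$ be finite undirected loopless graphs (multiple edges allowed) such that $G'$ is obtained from $G$ by a finite sequence of the following operations: identification, cleaving, and twisting (and then possibly a graph isomorphism). Then the algebras $\mathcal{C}^F_G$ and $\mathcal{C}^F_{G'}$ are isomorphic.
   Context: For a graph $G$ with vertices $1,\dots,n$, let $\Phi^F_G$ be the commutative $\mathbb{K}$-algebra generated by variables $\phi_e$, $e\in E(G)$, subject to $\phi_e^2=0$ for all $e$. For $i=1,\dots,n$ put $X_i=\sum_{e\in E(G)}c_{i,e}\phi_e$, where $c_{i,e}=1$ if $e=(i,j)$ with $i<j$, $c_{i,e}=-1$ if $e=(i,j)$ with $i>j$, and $c_{i,e}=0$ if $i$ is not an endpoint of $e$. $\mathcal{C}^F_G$ is the subalgebra of $\Phi^F_G$ generated by $X_1,\dots,X_n$. Operations: (Identification) if $v,v'$ lie in different connected components, identify them into one vertex. (Cleaving) the inverse of identification, allowed only at a cut-vertex. (Twisting) if $G$ is obtained from disjoint graphs $G_1,G_2$ by identifying $u_1\in V(G_1)$ with $u_2\in V(G_2)$ into $u$ and $v_1\in V(G_1)$ with $v_2\in V(G_2)$ into $v$, the twist of $G$ about $\{u,v\}$ is the graph obtained from $G_1,G_2$ by instead identifying $u_1$ with $v_2$ and $u_2$ with $v_1$. -}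

module Defs where

open import Level using (Level; _⊔_) renaming (suc to lsuc)
open import Data.Nat using (ℕ; zero; suc)
open import Data.Fin using (Fin; zero; suc; _<?_) renaming (_≟_ to _≟ᶠ_)
open import Data.Bool using (Bool; true; false; if_then_else_)
open import Data.Product using (Σ; ∃; ∃-syntax; _×_; _,_; proj₁; proj₂)
open import Data.Sum using (_⊎_)
open import Relation.Nullary using (¬_; does)
open import Relation.Binary.PropositionalEquality using (_≡_; _≢_)
open import Relation.Binary.Construct.Closure.ReflexiveTransitive using (Star)
open import Function.Bundles using (_↔_; _⇔_; Inverse)
open import Algebra.Bundles using (CommutativeRing)

record Field (c ℓ : Level) : Set (lsuc (c ⊔ ℓ)) where
  field
    commutativeRing : CommutativeRing c ℓ
  open CommutativeRing commutativeRing public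
  field
    1≉0     : ¬ (1# ≈ 0#)
    inverse : ∀ x → ¬ (x ≈ 0#) → ∃[ y ] (x * y ≈ 1#)

module FieldNat {c ℓ} (F : Field c ℓ) where
  open Field F hiding (zero)
  ℕ→K : ℕ → Carrier
  ℕ→K zero    = 0#
  ℕ→K (suc n) = 1# + ℕ→K n

CharZero : ∀ {c ℓ} → Field c ℓ → Set ℓ
CharZero F = ∀ n → ¬ (ℕ→K (suc n) ≈ 0#)
  where open Field F hiding (zero); open FieldNat F

-- An edge's two endpoints are stored
-- as a pair; the order of the pair carries no meaning (see SamePair).

record Graph : Set where
  field
    nV nE    : ℕ
    ends     : Fin nE → Fin nV × Fin nV
    loopless : ∀ e → proj₁ (ends e) ≢ proj₂ (ends e)
open Graph public

SamePair : ∀ {n} → Fin n × Fin n → Fin n × Fin n → Set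
SamePair (a , b) (c , d) = (a ≡ c × b ≡ d) ⊎ (a ≡ d × b ≡ c)

data Reach (G : Graph) (x : Fin (nV G)) : Fin (nV G) → Set where
  here : Reach G x x
  step : ∀ {y z} (e : Fin (nE G)) → Reach G x y → SamePair (ends G e) (y , z) → Reach G x z

record Merge (G H : Graph) : Set where
  field
    q       : Fin (nV G) → Fin (nV H)
    q-surj  : ∀ y → ∃[ x ] (q x ≡ y)
    σ       : Fin (nE G) ↔ Fin (nE H)
    compat  : ∀ e → SamePair (ends H (Inverse.to σ e))
                             (q (proj₁ (ends G e)) , q (proj₂ (ends G e)))
open Merge public

Iso : Graph → Graph → Set
Iso G H = Σ (Merge G H) λ M → ∀ x y → q M x ≡ q M y → x ≡ y

KernelIs1 : ∀ {G H} → Merge G H → (a b : Fin (nV G)) → Set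
KernelIs1 M a b = ∀ x y → (q M x ≡ q M y) ⇔ (x ≡ y ⊎ SamePair (x , y) (a , b))

KernelIs2 : ∀ {G H} → Merge G H → (a b c d : Fin (nV G)) → Set
KernelIs2 M a b c d = ∀ x y → (q M x ≡ q M y)
  ⇔ (x ≡ y ⊎ (SamePair (x , y) (a , b) ⊎ SamePair (x , y) (c , d)))

Identification : Graph → Graph → Set
Identification G H =
  Σ (Fin (nV G)) λ v → Σ (Fin (nV G)) λ v' →
    ¬ Reach G v v' × Σ (Merge G H) λ M → KernelIs1 M v v'

-- Twisting: D is the disjoint union of G1 (side true) and G2 (side false);
-- u1 , v1 ∈ G1 distinct, u2 , v2 ∈ G2 distinct;
-- G ≅ D/(u1~u2, v1~v2) and H ≅ D/(u1~v2, u2~v1).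
Twisting : Graph → Graph → Set
Twisting G H =
  Σ Graph λ D → Σ (Fin (nV D) → Bool) λ side →
    (∀ e → side (proj₁ (ends D e)) ≡ side (proj₂ (ends D e))) ×
    Σ (Fin (nV D)) λ u1 → Σ (Fin (nV D)) λ v1 →
    Σ (Fin (nV D)) λ u2 → Σ (Fin (nV D)) λ v2 →
      side u1 ≡ true × side v1 ≡ true × side u2 ≡ false × side v2 ≡ false ×
      u1 ≢ v1 × u2 ≢ v2 ×
      (Σ (Merge D G) λ M → KernelIs2 M u1 u2 v1 v2) ×
      (Σ (Merge D H) λ M → KernelIs2 M u1 v2 u2 v1)

-- one operation: identification, cleaving (inverse of identification),
-- twisting, or a graph isomorphism
Step : Graph → Graph → Set
Step G H = Identification G H ⊎ Identification H G ⊎ Twisting G H ⊎ Iso G H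

Obtainable : Graph → Graph → Set
Obtainable = Star Step

module Alg {c ℓ} (F : Field c ℓ) where
  open Field F hiding (zero)

  -- Φ m = K[φ_0 , … , φ_{m-1}] / (φ_e²), stored in its monomial basis:
  -- an element of Φ (suc m) is  a +φ b  standing for a + b φ_0,
  -- with a , b polynomials in the remaining variables φ_1 … φ_m.
  data Φ : ℕ → Set c where
    ⟨_⟩  : Carrier → Φ zero
    _+φ_ : ∀ {m} → Φ m → Φ m → Φ (suc m)

  _≈Φ_ : ∀ {m} → Φ m → Φ m → Set ℓ
  ⟨ x ⟩ ≈Φ ⟨ y ⟩ = x ≈ y
  (a +φ b) ≈Φ (a' +φ b') = (a ≈Φ a') × (b ≈Φ b')

  0Φ : ∀ {m} → Φ m
  0Φ {zero}  = ⟨ 0# ⟩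
  0Φ {suc m} = 0Φ +φ 0Φ

  1Φ : ∀ {m} → Φ m
  1Φ {zero}  = ⟨ 1# ⟩
  1Φ {suc m} = 1Φ +φ 0Φ

  _+Φ_ : ∀ {m} → Φ m → Φ m → Φ m
  ⟨ x ⟩ +Φ ⟨ y ⟩ = ⟨ x + y ⟩
  (a +φ b) +Φ (a' +φ b') = (a +Φ a') +φ (b +Φ b')

  _·Φ_ : ∀ {m} → Carrier → Φ m → Φ m
  k ·Φ ⟨ x ⟩ = ⟨ k * x ⟩
  k ·Φ (a +φ b) = (k ·Φ a) +φ (k ·Φ b)

  -- (a + b φ)(a' + b' φ) = a a' + (a b' + b a') φ   since φ² = 0
  _*Φ_ : ∀ {m} → Φ m → Φ m → Φ m
  ⟨ x ⟩ *Φ ⟨ y ⟩ = ⟨ x * y ⟩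
  (a +φ b) *Φ (a' +φ b') = (a *Φ a') +φ ((a *Φ b') +Φ (b *Φ a'))

  φ : ∀ {m} → Fin m → Φ m
  φ zero    = 0Φ +φ 1Φ
  φ (suc e) = φ e +φ 0Φ

  sumFin : ∀ {m k} → (Fin k → Φ m) → Φ m
  sumFin {k = zero}  f = 0Φ
  sumFin {k = suc k} f = f zero +Φ sumFin (λ i → f (suc i))

  coeff : (G : Graph) → Fin (nV G) → Fin (nE G) → Carrier
  coeff G i e with ends G e
  ... | (a , b) =
    if does (i ≟ᶠ a) then (if does (a <? b) then 1# else - 1#)
    else if does (i ≟ᶠ b) then (if does (b <? a) then 1# else - 1#)
    else 0#

  X : (G : Graph) → Fin (nV G) → Φ (nE G)
  X G i = sumFin (λ e → coeff G i e ·Φ φ e)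

  data Term (n : ℕ) : Set c where
    var   : Fin n → Term n
    const : Carrier → Term n
    _⊕_   : Term n → Term n → Term n
    _⊗_   : Term n → Term n → Term n

  eval : ∀ {n m} → (Fin n → Φ m) → Term n → Φ m
  eval v (var i)   = v i
  eval v (const k) = k ·Φ 1Φ
  eval v (s ⊕ t)   = eval v s +Φ eval v t
  eval v (s ⊗ t)   = eval v s *Φ eval v t

  InC : (G : Graph) → Φ (nE G) → Set (c ⊔ ℓ)
  InC G x = ∃[ t ] (x ≈Φ eval (X G) t)

  C : Graph → Set (c ⊔ ℓ)
  C G = Σ (Φ (nE G)) (InC G)

  record AlgIso (G H : Graph) : Set (c ⊔ ℓ) where
    field
      f       : C G → Φ (nE H)
      closed  : ∀ x → InC H (f x)
      resp    : ∀ x y → proj₁ x ≈Φ proj₁ y → f x ≈Φ f y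
      inj     : ∀ x y → f x ≈Φ f y → proj₁ x ≈Φ proj₁ y
      surj    : ∀ y → InC H y → ∃[ x ] (f x ≈Φ y)
      pres-+  : ∀ x y z → (proj₁ x +Φ proj₁ y) ≈Φ proj₁ z → f z ≈Φ (f x +Φ f y)
      pres-*  : ∀ x y z → (proj₁ x *Φ proj₁ y) ≈Φ proj₁ z → f z ≈Φ (f x *Φ f y)
      pres-·  : ∀ k x z → (k ·Φ proj₁ x) ≈Φ proj₁ z → f z ≈Φ (k ·Φ f x)
      pres-1  : ∀ x → proj₁ x ≈Φ 1Φ → f x ≈Φ 1Φ

-- A vertex-merging map q : G → H comes with a bijection σ of edges, and the signed
-- relabelling φ_{σ e} ↦ ±φ_e is an algebra isomorphism Φ_H ≅ Φ_G sending X_j to the fibre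
-- sum ∑_{q i = j} X_i. So C_H is the subalgebra of Φ_G generated by the fibre sums, and it
-- suffices to show that the fibre sums and the X_i generate each other. The key relation is
-- ∑_{k ∈ T} X_k = 0 for every vertex set T closed under edges. Identifying v with v' from
-- another component: X_v is minus the sum of the other X_k over the component of v, all of
-- them fibres, and then X_v' = (X_v + X_v') − X_v. Twisting: G and G' are two quotients of
-- the disjoint union D = G₁ ⊔ G₂; after negating φ_e on the edges of G₂ the merged fibres
-- X_u₁ − X_v₂, X_v₁ − X_u₂ of one and X_u₁ + X_u₂, X_v₁ + X_v₂ of the other differ by
-- ±(X_u₂ + X_v₂), which the component relation expresses through unmerged vertices of G₂.

module Submission where

open import Level using (Level; _⊔_)
open import Data.Nat using (ℕ; zero; suc)
open import Data.Fin using (Fin; zero; suc; _≟_; _<?_)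
open import Data.Fin.Properties using (suc-injective; all?; ¬∀⟶∃¬; <-cmp; <-asym)
open import Data.Fin.Subset using (Subset; _∈_; _∉_; _⊃_; _∪_; ⁅_⁆)
open import Data.Fin.Subset.Properties using (p⊆p∪q; x∈p∪q⁺; x∈p∪q⁻; x∈⁅x⁆; x∈⁅y⁆⇒x≡y)
open import Data.Fin.Subset.Induction using (Acc; acc; ⊃-wellFounded)
open import Data.Vec using (lookup)
open import Data.Vec.Properties using ([]=⇒lookup; lookup⇒[]=)
open import Data.Bool using (Bool; true; false; if_then_else_; _∧_; _∨_; not)
import Data.Bool.Properties as Bool
open import Data.Product using (∃-syntax; _×_; _,_; proj₁; proj₂)
open import Data.Sum using (_⊎_; inj₁; inj₂; [_,_]′)
import Data.Sum as Sum
open import Function using (_∘_; id; _↔_; Inverse)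
open import Function.Bundles using (Equivalence; mk⇔)
open import Function.Construct.Identity using (↔-id)
open import Relation.Nullary using (¬_; Dec; yes; no; does; contradiction)
open import Relation.Nullary.Decidable using (dec-true; dec-false)
open import Relation.Binary using (tri<; tri≈; tri>)
open import Relation.Binary.PropositionalEquality as ≡ using (_≡_; _≢_)
import Relation.Binary.Construct.Closure.ReflexiveTransitive as Star
import Relation.Binary.Reasoning.Setoid as SetoidReasoning
open import Algebra.Bundles using (CommutativeMonoid; CommutativeRing)
import Algebra.Properties.Ring as RingProperties
import Algebra.Solver.Ring.NaturalCoefficients.Default as SemiringSolver
open import Defs

module FiniteSums {a b} (M : CommutativeMonoid a b) where
  open CommutativeMonoid M
  open import Algebra.Properties.CommutativeMonoid.Sum M public

  sum-vanishing : ∀ {n} (f : Fin n → Carrier) → (∀ i → f i ≈ ε) → sum f ≈ ε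
  sum-vanishing {zero}  f f≈ε = refl
  sum-vanishing {suc n} f f≈ε =
    trans (∙-cong (f≈ε zero) (sum-vanishing (λ i → f (suc i)) (λ i → f≈ε (suc i)))) (identityˡ ε)

  sum-single : ∀ {n} (f : Fin n → Carrier) a → (∀ i → i ≢ a → f i ≈ ε) → sum f ≈ f a
  sum-single f zero    f≈ε = trans (∙-congˡ (sum-vanishing _ (λ i → f≈ε (suc i) λ ()))) (identityʳ _)
  sum-single f (suc a) f≈ε =
    trans (∙-cong (f≈ε zero λ ()) (sum-single (λ i → f (suc i)) a (λ i i≢a → f≈ε (suc i) (i≢a ∘ suc-injective))))
          (identityˡ _)

  sum-pair : ∀ {n} (f : Fin n → Carrier) a b → a ≢ b → (∀ i → i ≢ a → i ≢ b → f i ≈ ε) →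
             sum f ≈ f a ∙ f b
  sum-pair f zero    zero    a≢b _   = contradiction ≡.refl a≢b
  sum-pair f zero    (suc b) _   f≈ε =
    ∙-congˡ (sum-single (λ i → f (suc i)) b λ i i≢b → f≈ε (suc i) (λ ()) (i≢b ∘ suc-injective))
  sum-pair f (suc a) zero    _   f≈ε =
    trans (∙-congˡ (sum-single (λ i → f (suc i)) a λ i i≢a → f≈ε (suc i) (i≢a ∘ suc-injective) (λ ()))) (comm _ _)
  sum-pair f (suc a) (suc b) a≢b f≈ε =
    trans (∙-cong (f≈ε zero (λ ()) (λ ()))
                  (sum-pair (λ i → f (suc i)) a b (a≢b ∘ ≡.cong suc)
                            (λ i i≢a i≢b → f≈ε (suc i) (i≢a ∘ suc-injective) (i≢b ∘ suc-injective))))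
          (identityˡ _)

_≡ᵇ_ : ∀ {n} → Fin n → Fin n → Bool
i ≡ᵇ j = does (i ≟ j)

≡ᵇ⇒≡ : ∀ {n} {i j : Fin n} → i ≡ᵇ j ≡ true → i ≡ j
≡ᵇ⇒≡ {i = i} {j} i≡ᵇj with i ≟ j
... | yes i≡j = i≡j

≡ᵇ-refl : ∀ {n} (i : Fin n) → i ≡ᵇ i ≡ true
≡ᵇ-refl i = dec-true (i ≟ i) ≡.refl

true≢false : true ≢ false
true≢false ()

≡ᵇ-false⇒≢ : ∀ {n} {i j : Fin n} → i ≡ᵇ j ≡ false → i ≢ j
≡ᵇ-false⇒≢ {i = i} i≢ᵇj ≡.refl = true≢false (≡.trans (≡.sym (≡ᵇ-refl i)) i≢ᵇj)

module _ {n : ℕ} (a b : Fin n) where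
  pair : Fin n → Bool
  pair k = k ≡ᵇ a ∨ k ≡ᵇ b

  pair-member : ∀ {k} → pair k ≡ true → k ≡ a ⊎ k ≡ b
  pair-member {k} k∈ with k ≟ a | k ≟ b
  ... | yes k≡a | _       = inj₁ k≡a
  ... | no _    | yes k≡b = inj₂ k≡b
  ... | no _    | no _    = contradiction k∈ λ ()

  pair-nonmember : ∀ {k} → pair k ≡ false → k ≢ a × k ≢ b
  pair-nonmember {k} k∉ with k ≟ a | k ≟ b
  ... | no k≢a | no k≢b = k≢a , k≢b

  pair-includes : pair a ≡ true × pair b ≡ true
  pair-includes = ≡.cong (_∨ a ≡ᵇ b) (≡ᵇ-refl a) , ≡.trans (≡.cong (b ≡ᵇ a ∨_) (≡ᵇ-refl b)) (Bool.∨-zeroʳ _)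

∨-true : ∀ {x y} → x ∨ y ≡ true → x ≡ true ⊎ y ≡ true
∨-true {true}  _   = inj₁ ≡.refl
∨-true {false} y≡t = inj₂ y≡t

EdgeClosed : (G : Graph) → (Fin (nV G) → Bool) → Set
EdgeClosed G T = ∀ e → T (proj₁ (ends G e)) ≡ T (proj₂ (ends G e))

closed-constant-on-Reach : ∀ {G T} → EdgeClosed G T → ∀ {x k} → Reach G x k → T k ≡ T x
closed-constant-on-Reach closed here = ≡.refl
closed-constant-on-Reach closed (step e r (inj₁ (≡.refl , ≡.refl))) =
  ≡.trans (≡.sym (closed e)) (closed-constant-on-Reach closed r)
closed-constant-on-Reach closed (step e r (inj₂ (≡.refl , ≡.refl))) =
  ≡.trans (closed e) (closed-constant-on-Reach closed r)

record Component (G : Graph) (v : Fin (nV G)) : Set where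
  field
    member    : Fin (nV G) → Bool
    closed    : EdgeClosed G member
    centre    : member v ≡ true
    reachable : ∀ {k} → member k ≡ true → Reach G v k

module _ (G : Graph) (v : Fin (nV G)) where
  private
    Reachable : Subset (nV G) → Set
    Reachable S = ∀ {k} → k ∈ S → Reach G v k

    record Boundary (S : Subset (nV G)) : Set where
      field
        edge        : Fin (nE G)
        inner outer : Fin (nV G)
        inner∈S     : inner ∈ S
        outer∉S     : outer ∉ S
        joins       : SamePair (ends G edge) (inner , outer)

    ends-agree? : ∀ S e → Dec (lookup S (proj₁ (ends G e)) ≡ lookup S (proj₂ (ends G e)))
    ends-agree? S e = lookup S (proj₁ (ends G e)) Bool.≟ lookup S (proj₂ (ends G e))

    boundary : ∀ S → ¬ EdgeClosed G (lookup S) → Boundary S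
    boundary S open-set
      with (e , ends-differ) ← ¬∀⟶∃¬ _ _ (ends-agree? S) open-set
      with lookup S (proj₁ (ends G e)) in s₁ | lookup S (proj₂ (ends G e)) in s₂
    ... | true  | true  = contradiction ≡.refl ends-differ
    ... | false | false = contradiction ≡.refl ends-differ
    ... | true  | false = record
      { edge = e ; inner∈S = lookup⇒[]= _ S s₁ ; outer∉S = λ o∈S → true≢false (≡.trans (≡.sym ([]=⇒lookup o∈S)) s₂)
      ; joins = inj₁ (≡.refl , ≡.refl) }
    ... | false | true  = record
      { edge = e ; inner∈S = lookup⇒[]= _ S s₂ ; outer∉S = λ o∈S → true≢false (≡.trans (≡.sym ([]=⇒lookup o∈S)) s₁)
      ; joins = inj₂ (≡.refl , ≡.refl) }

    grow : ∀ S → Acc _⊃_ S → v ∈ S → Reachable S → Component G v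
    grow S (acc smaller) v∈S reach with all? (ends-agree? S)
    ... | yes closed = record
      { member = lookup S ; closed = closed ; centre = []=⇒lookup v∈S
      ; reachable = λ {k} k∈S → reach (lookup⇒[]= k S k∈S) }
    ... | no open-set = grow (S ∪ ⁅ outer ⁆) (smaller S'⊃S) (p⊆p∪q _ v∈S) reach'
      where
      open Boundary (boundary S open-set)
      S'⊃S : (S ∪ ⁅ outer ⁆) ⊃ S
      S'⊃S = p⊆p∪q _ , outer , x∈p∪q⁺ (inj₂ (x∈⁅x⁆ outer)) , outer∉S
      reach' : Reachable (S ∪ ⁅ outer ⁆)
      reach' k∈S' with x∈p∪q⁻ S _ k∈S'
      ... | inj₁ k∈S  = reach k∈S
      ... | inj₂ k∈⁅o⁆ rewrite x∈⁅y⁆⇒x≡y outer k∈⁅o⁆ = step edge (reach inner∈S) joins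

  component : Component G v
  component = grow ⁅ v ⁆ (⊃-wellFounded _) (x∈⁅x⁆ v) (λ k∈⁅v⁆ → ≡.subst (Reach G v) (≡.sym (x∈⁅y⁆⇒x≡y v k∈⁅v⁆)) here)

module Kernels {G H : Graph} (M : Merge G H) where
  open Equivalence

  Isolated : Fin (nV G) → Set
  Isolated k = ∀ i → q M i ≡ q M k → i ≡ k

  private
    first-of : ∀ {n} {i k a b : Fin n} → SamePair (i , k) (a , b) → i ≡ a ⊎ i ≡ b
    first-of (inj₁ (i≡a , _)) = inj₁ i≡a
    first-of (inj₂ (i≡b , _)) = inj₂ i≡b

    second-of : ∀ {n} {i k a b : Fin n} → SamePair (i , k) (a , b) → k ≡ a ⊎ k ≡ b
    second-of (inj₁ (_ , k≡b)) = inj₂ k≡b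
    second-of (inj₂ (_ , k≡a)) = inj₁ k≡a

  module _ {a b : Fin (nV G)} (K : KernelIs1 M a b) where
    glued₁ : q M b ≡ q M a
    glued₁ = from (K b a) (inj₂ (inj₂ (≡.refl , ≡.refl)))

    same-fibre₁ : ∀ i → q M i ≡ q M a → i ≡ a ⊎ i ≡ b
    same-fibre₁ i qi≡qa with to (K i a) qi≡qa
    ... | inj₁ i≡a  = inj₁ i≡a
    ... | inj₂ i~a  = first-of i~a

    outside⇒isolated₁ : ∀ {k} → k ≢ a → k ≢ b → Isolated k
    outside⇒isolated₁ {k} k≢a k≢b i qi≡qk with to (K i k) qi≡qk
    ... | inj₁ i≡k = i≡k
    ... | inj₂ i~k = contradiction (second-of i~k) [ k≢a , k≢b ]′

  module _ {a b c d : Fin (nV G)} (K : KernelIs2 M a b c d) where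
    glued₂ : q M b ≡ q M a
    glued₂ = from (K b a) (inj₂ (inj₁ (inj₂ (≡.refl , ≡.refl))))

    swap₂ : KernelIs2 M c d a b
    swap₂ x y = mk⇔ (Sum.map₂ Sum.swap ∘ to (K x y)) (from (K x y) ∘ Sum.map₂ Sum.swap)

    same-fibre₂ : a ≢ c → a ≢ d → ∀ i → q M i ≡ q M a → i ≡ a ⊎ i ≡ b
    same-fibre₂ a≢c a≢d i qi≡qa with to (K i a) qi≡qa
    ... | inj₁ i≡a                  = inj₁ i≡a
    ... | inj₂ (inj₁ i~a)           = first-of i~a
    ... | inj₂ (inj₂ (inj₁ (_ , a≡d))) = contradiction a≡d a≢d
    ... | inj₂ (inj₂ (inj₂ (_ , a≡c))) = contradiction a≡c a≢c

    outside⇒isolated₂ : ∀ {k} → k ≢ a → k ≢ b → k ≢ c → k ≢ d → Isolated k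
    outside⇒isolated₂ {k} k≢a k≢b k≢c k≢d i qi≡qk with to (K i k) qi≡qk
    ... | inj₁ i≡k        = i≡k
    ... | inj₂ (inj₁ i~k) = contradiction (second-of i~k) [ k≢a , k≢b ]′
    ... | inj₂ (inj₂ i~k) = contradiction (second-of i~k) [ k≢c , k≢d ]′

module PhiRing {c ℓ} (F : Field c ℓ) where
  open Field F hiding (zero)
  open Alg F

  -- An inductive copy of _≈Φ_: unlike the recursive definition it lets Agda
  -- recover the index m and the arguments from a proof.
  infix 4 _≃_
  data _≃_ : ∀ {m} → Φ m → Φ m → Set (c ⊔ ℓ) where
    base   : ∀ {x y} → x ≈ y → ⟨ x ⟩ ≃ ⟨ y ⟩
    _+φ≃_ : ∀ {m} {a a' b b' : Φ m} → a ≃ a' → b ≃ b' → (a +φ b) ≃ (a' +φ b')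

  ≃⇒≈Φ : ∀ {m} {x y : Φ m} → x ≃ y → x ≈Φ y
  ≃⇒≈Φ (base p)    = p
  ≃⇒≈Φ (p +φ≃ q) = ≃⇒≈Φ p , ≃⇒≈Φ q

  ≈Φ⇒≃ : ∀ {m} {x y : Φ m} → x ≈Φ y → x ≃ y
  ≈Φ⇒≃ {x = ⟨ _ ⟩}  {⟨ _ ⟩}  p       = base p
  ≈Φ⇒≃ {x = _ +φ _} {_ +φ _} (p , q) = ≈Φ⇒≃ p +φ≃ ≈Φ⇒≃ q

  ≃-refl : ∀ {m} {x : Φ m} → x ≃ x
  ≃-refl {x = ⟨ x ⟩}  = base refl
  ≃-refl {x = a +φ b} = ≃-refl +φ≃ ≃-refl

  ≃-reflexive : ∀ {m} {x y : Φ m} → x ≡ y → x ≃ y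
  ≃-reflexive ≡.refl = ≃-refl

  ≃-sym : ∀ {m} {x y : Φ m} → x ≃ y → y ≃ x
  ≃-sym (base p)    = base (sym p)
  ≃-sym (p +φ≃ q) = ≃-sym p +φ≃ ≃-sym q

  ≃-trans : ∀ {m} {x y z : Φ m} → x ≃ y → y ≃ z → x ≃ z
  ≃-trans (base p)    (base q)      = base (trans p q)
  ≃-trans (p +φ≃ q) (p' +φ≃ q') = ≃-trans p p' +φ≃ ≃-trans q q'

  +Φ-cong : ∀ {m} {x x' y y' : Φ m} → x ≃ x' → y ≃ y' → (x +Φ y) ≃ (x' +Φ y')
  +Φ-cong (base p)    (base q)      = base (+-cong p q)
  +Φ-cong (p +φ≃ q) (p' +φ≃ q') = +Φ-cong p p' +φ≃ +Φ-cong q q'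

  +Φ-comm : ∀ {m} (x y : Φ m) → (x +Φ y) ≃ (y +Φ x)
  +Φ-comm ⟨ x ⟩    ⟨ y ⟩      = base (+-comm x y)
  +Φ-comm (a +φ b) (a' +φ b') = +Φ-comm a a' +φ≃ +Φ-comm b b'

  +Φ-assoc : ∀ {m} (x y z : Φ m) → ((x +Φ y) +Φ z) ≃ (x +Φ (y +Φ z))
  +Φ-assoc ⟨ x ⟩    ⟨ y ⟩      ⟨ z ⟩        = base (+-assoc x y z)
  +Φ-assoc (a +φ b) (a' +φ b') (a'' +φ b'') = +Φ-assoc a a' a'' +φ≃ +Φ-assoc b b' b''

  +Φ-identityˡ : ∀ {m} (x : Φ m) → (0Φ +Φ x) ≃ x
  +Φ-identityˡ ⟨ x ⟩    = base (+-identityˡ x)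
  +Φ-identityˡ (a +φ b) = +Φ-identityˡ a +φ≃ +Φ-identityˡ b

  +Φ-identityʳ : ∀ {m} (x : Φ m) → (x +Φ 0Φ) ≃ x
  +Φ-identityʳ x = ≃-trans (+Φ-comm x 0Φ) (+Φ-identityˡ x)

  +Φ-interchange : ∀ {m} (p q r s : Φ m) → ((p +Φ q) +Φ (r +Φ s)) ≃ ((p +Φ r) +Φ (q +Φ s))
  +Φ-interchange p q r s =
    ≃-trans (+Φ-assoc p q (r +Φ s))
   (≃-trans (+Φ-cong ≃-refl (≃-trans (≃-sym (+Φ-assoc q r s))
                           (≃-trans (+Φ-cong (+Φ-comm q r) ≃-refl) (+Φ-assoc r q s))))
            (≃-sym (+Φ-assoc p r (q +Φ s))))

  ·Φ-cong : ∀ {m} {k k'} {x x' : Φ m} → k ≈ k' → x ≃ x' → (k ·Φ x) ≃ (k' ·Φ x')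
  ·Φ-cong k≈k' (base p)    = base (*-cong k≈k' p)
  ·Φ-cong k≈k' (p +φ≃ q) = ·Φ-cong k≈k' p +φ≃ ·Φ-cong k≈k' q

  ·Φ-congˡ : ∀ {m} {k k'} (x : Φ m) → k ≈ k' → (k ·Φ x) ≃ (k' ·Φ x)
  ·Φ-congˡ x k≈k' = ·Φ-cong k≈k' ≃-refl

  ·Φ-distribˡ : ∀ {m} k (x y : Φ m) → (k ·Φ (x +Φ y)) ≃ ((k ·Φ x) +Φ (k ·Φ y))
  ·Φ-distribˡ k ⟨ x ⟩    ⟨ y ⟩      = base (distribˡ k x y)
  ·Φ-distribˡ k (a +φ b) (a' +φ b') = ·Φ-distribˡ k a a' +φ≃ ·Φ-distribˡ k b b'

  ·Φ-distribʳ : ∀ {m} k l (x : Φ m) → ((k + l) ·Φ x) ≃ ((k ·Φ x) +Φ (l ·Φ x))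
  ·Φ-distribʳ k l ⟨ x ⟩    = base (distribʳ x k l)
  ·Φ-distribʳ k l (a +φ b) = ·Φ-distribʳ k l a +φ≃ ·Φ-distribʳ k l b

  ·Φ-assoc : ∀ {m} k l (x : Φ m) → (k ·Φ (l ·Φ x)) ≃ ((k * l) ·Φ x)
  ·Φ-assoc k l ⟨ x ⟩    = base (sym (*-assoc k l x))
  ·Φ-assoc k l (a +φ b) = ·Φ-assoc k l a +φ≃ ·Φ-assoc k l b

  ·Φ-identity : ∀ {m} (x : Φ m) → (1# ·Φ x) ≃ x
  ·Φ-identity ⟨ x ⟩    = base (*-identityˡ x)
  ·Φ-identity (a +φ b) = ·Φ-identity a +φ≃ ·Φ-identity b

  ·Φ-zeroˡ : ∀ {m} (x : Φ m) → (0# ·Φ x) ≃ 0Φ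
  ·Φ-zeroˡ ⟨ x ⟩    = base (zeroˡ x)
  ·Φ-zeroˡ (a +φ b) = ·Φ-zeroˡ a +φ≃ ·Φ-zeroˡ b

  ·Φ-zeroʳ : ∀ {m} k → (k ·Φ 0Φ {m}) ≃ 0Φ
  ·Φ-zeroʳ {zero}  k = base (zeroʳ k)
  ·Φ-zeroʳ {suc m} k = ·Φ-zeroʳ k +φ≃ ·Φ-zeroʳ k

  *Φ-cong : ∀ {m} {x x' y y' : Φ m} → x ≃ x' → y ≃ y' → (x *Φ y) ≃ (x' *Φ y')
  *Φ-cong (base p)    (base q)      = base (*-cong p q)
  *Φ-cong (p +φ≃ q) (p' +φ≃ q') = *Φ-cong p p' +φ≃ +Φ-cong (*Φ-cong p q') (*Φ-cong q p')

  *Φ-comm : ∀ {m} (x y : Φ m) → (x *Φ y) ≃ (y *Φ x)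
  *Φ-comm ⟨ x ⟩    ⟨ y ⟩      = base (*-comm x y)
  *Φ-comm (a +φ b) (a' +φ b') =
    *Φ-comm a a' +φ≃ ≃-trans (+Φ-comm _ _) (+Φ-cong (*Φ-comm b a') (*Φ-comm a b'))

  *Φ-distribˡ : ∀ {m} (x y z : Φ m) → (x *Φ (y +Φ z)) ≃ ((x *Φ y) +Φ (x *Φ z))
  *Φ-distribˡ ⟨ x ⟩    ⟨ y ⟩      ⟨ z ⟩        = base (distribˡ x y z)
  *Φ-distribˡ (a +φ b) (a' +φ b') (a'' +φ b'') =
    *Φ-distribˡ a a' a'' +φ≃ ≃-trans (+Φ-cong (*Φ-distribˡ a b' b'') (*Φ-distribˡ b a' a'')) (+Φ-interchange _ _ _ _)

  *Φ-distribʳ : ∀ {m} (x y z : Φ m) → ((y +Φ z) *Φ x) ≃ ((y *Φ x) +Φ (z *Φ x))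
  *Φ-distribʳ x y z = ≃-trans (*Φ-comm _ x) (≃-trans (*Φ-distribˡ x y z) (+Φ-cong (*Φ-comm x y) (*Φ-comm x z)))

  *Φ-zeroʳ : ∀ {m} (x : Φ m) → (x *Φ 0Φ) ≃ 0Φ
  *Φ-zeroʳ ⟨ x ⟩    = base (zeroʳ x)
  *Φ-zeroʳ (a +φ b) = *Φ-zeroʳ a +φ≃ ≃-trans (+Φ-cong (*Φ-zeroʳ a) (*Φ-zeroʳ b)) (+Φ-identityˡ 0Φ)

  *Φ-identityʳ : ∀ {m} (x : Φ m) → (x *Φ 1Φ) ≃ x
  *Φ-identityʳ ⟨ x ⟩    = base (*-identityʳ x)
  *Φ-identityʳ (a +φ b) = *Φ-identityʳ a +φ≃ ≃-trans (+Φ-cong (*Φ-zeroʳ a) (*Φ-identityʳ b)) (+Φ-identityˡ b)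

  *Φ-identityˡ : ∀ {m} (x : Φ m) → (1Φ *Φ x) ≃ x
  *Φ-identityˡ x = ≃-trans (*Φ-comm 1Φ x) (*Φ-identityʳ x)

  *Φ-assoc : ∀ {m} (x y z : Φ m) → ((x *Φ y) *Φ z) ≃ (x *Φ (y *Φ z))
  *Φ-assoc ⟨ x ⟩    ⟨ y ⟩      ⟨ z ⟩        = base (*-assoc x y z)
  *Φ-assoc (a +φ b) (a' +φ b') (a'' +φ b'') = *Φ-assoc a a' a'' +φ≃
    ≃-trans (+Φ-cong (*Φ-assoc a a' b'') (*Φ-distribʳ a'' (a *Φ b') (b *Φ a')))
   (≃-trans (≃-sym (+Φ-assoc _ _ _))
            (+Φ-cong (≃-trans (+Φ-cong ≃-refl (*Φ-assoc a b' a'')) (≃-sym (*Φ-distribˡ a _ _)))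
                     (*Φ-assoc b a' a'')))

  ·Φ-*Φ : ∀ {m} k (x y : Φ m) → (k ·Φ (x *Φ y)) ≃ ((k ·Φ x) *Φ y)
  ·Φ-*Φ k ⟨ x ⟩    ⟨ y ⟩      = base (sym (*-assoc k x y))
  ·Φ-*Φ k (a +φ b) (a' +φ b') =
    ·Φ-*Φ k a a' +φ≃ ≃-trans (·Φ-distribˡ k _ _) (+Φ-cong (·Φ-*Φ k a b') (·Φ-*Φ k b a'))

  -Φ_ : ∀ {m} → Φ m → Φ m
  -Φ x = (- 1#) ·Φ x

  -Φ-inverseʳ : ∀ {m} (x : Φ m) → (x +Φ (-Φ x)) ≃ 0Φ
  -Φ-inverseʳ x = ≃-trans (+Φ-cong (≃-sym (·Φ-identity x)) ≃-refl)
                 (≃-trans (≃-sym (·Φ-distribʳ 1# (- 1#) x))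
                 (≃-trans (·Φ-congˡ x (-‿inverseʳ 1#)) (·Φ-zeroˡ x)))

  Φ-commutativeRing : ℕ → CommutativeRing c (c ⊔ ℓ)
  Φ-commutativeRing m = record
    { Carrier = Φ m ; _≈_ = _≃_ ; _+_ = _+Φ_ ; _*_ = _*Φ_ ; -_ = -Φ_ ; 0# = 0Φ ; 1# = 1Φ
    ; isCommutativeRing = record
      { isRing = record
        { +-isAbelianGroup = record
          { isGroup = record
            { isMonoid = record
              { isSemigroup = record
                { isMagma = record
                  { isEquivalence = record { refl = ≃-refl ; sym = ≃-sym ; trans = ≃-trans }
                  ; ∙-cong = +Φ-cong }
                ; assoc = +Φ-assoc }
              ; identity = +Φ-identityˡ , +Φ-identityʳ }
            ; inverse = (λ x → ≃-trans (+Φ-comm _ x) (-Φ-inverseʳ x)) , -Φ-inverseʳ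
            ; ⁻¹-cong = ·Φ-cong refl }
          ; comm = +Φ-comm }
        ; *-cong = *Φ-cong
        ; *-assoc = *Φ-assoc
        ; *-identity = *Φ-identityˡ , *Φ-identityʳ
        ; distrib = *Φ-distribˡ , *Φ-distribʳ }
      ; *-comm = *Φ-comm } }

  module ΦRing {m : ℕ} = CommutativeRing (Φ-commutativeRing m)
  module ΦRingProperties {m : ℕ} = RingProperties (ΦRing.ring {m})
  module ≃-Reasoning {m : ℕ} = SetoidReasoning (ΦRing.setoid {m})
  module ΦSolver (m : ℕ) = SemiringSolver (ΦRing.commutativeSemiring {m})

  -Φ-cancel : ∀ {m} (a b c : Φ m) → ((a +Φ (-Φ c)) +Φ (b +Φ c)) ≃ (a +Φ b)
  -Φ-cancel {m} a b c = begin
    (a +Φ (-Φ c)) +Φ (b +Φ c)   ≈⟨ rearrange a b c (-Φ c) ⟩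
    (a +Φ b) +Φ (c +Φ (-Φ c))   ≈⟨ +Φ-cong ≃-refl (-Φ-inverseʳ c) ⟩
    (a +Φ b) +Φ 0Φ              ≈⟨ +Φ-identityʳ _ ⟩
    a +Φ b                      ∎
    where
    open ≃-Reasoning
    open ΦSolver m
    rearrange : ∀ a b c c' → ((a +Φ c') +Φ (b +Φ c)) ≃ ((a +Φ b) +Φ (c +Φ c'))
    rearrange = solve 4 (λ a b c c' → (a :+ c') :+ (b :+ c) := (a :+ b) :+ (c :+ c')) ≃-refl

module PhiMorphisms {c ℓ} (F : Field c ℓ) where
  open Field F hiding (zero)
  open Alg F
  open PhiRing F

  record AlgHom (m n : ℕ) : Set (c ⊔ ℓ) where
    field
      apply      : Φ m → Φ n
      apply-cong : ∀ {x y} → x ≃ y → apply x ≃ apply y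
      +-homo     : ∀ x y → apply (x +Φ y) ≃ (apply x +Φ apply y)
      *-homo     : ∀ x y → apply (x *Φ y) ≃ (apply x *Φ apply y)
      ·-homo     : ∀ k x → apply (k ·Φ x) ≃ (k ·Φ apply x)
      1-homo     : apply 1Φ ≃ 1Φ

    0-homo : apply 0Φ ≃ 0Φ
    0-homo = ≃-trans (apply-cong (≃-sym (·Φ-zeroˡ 1Φ))) (≃-trans (·-homo 0# 1Φ) (·Φ-zeroˡ _))

  open AlgHom public

  idHom : ∀ {m} → AlgHom m m
  idHom = record
    { apply = id ; apply-cong = id ; +-homo = λ _ _ → ≃-refl ; *-homo = λ _ _ → ≃-refl
    ; ·-homo = λ _ _ → ≃-refl ; 1-homo = ≃-refl }

  _∘Hom_ : ∀ {m n p} → AlgHom n p → AlgHom m n → AlgHom m p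
  H ∘Hom K = record
    { apply      = apply H ∘ apply K
    ; apply-cong = apply-cong H ∘ apply-cong K
    ; +-homo     = λ x y → ≃-trans (apply-cong H (+-homo K x y)) (+-homo H _ _)
    ; *-homo     = λ x y → ≃-trans (apply-cong H (*-homo K x y)) (*-homo H _ _)
    ; ·-homo     = λ k x → ≃-trans (apply-cong H (·-homo K k x)) (·-homo H _ _)
    ; 1-homo     = ≃-trans (apply-cong H (1-homo K)) (1-homo H) }

  liftHom : ∀ {m} → AlgHom m (suc m)
  liftHom = record
    { apply      = _+φ 0Φ
    ; apply-cong = _+φ≃ ≃-refl
    ; +-homo     = λ x y → ≃-refl +φ≃ ≃-sym (+Φ-identityˡ 0Φ)
    ; *-homo     = λ x y → ≃-refl +φ≃ ≃-sym (≃-trans (+Φ-cong (*Φ-zeroʳ x) (ΦRing.zeroˡ y)) (+Φ-identityˡ 0Φ))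
    ; ·-homo     = λ k x → ≃-refl +φ≃ ≃-sym (·Φ-zeroʳ k)
    ; 1-homo     = ≃-refl }

  φ-square : ∀ {m} (e : Fin m) → (φ e *Φ φ e) ≃ 0Φ
  φ-square zero    = *Φ-zeroʳ 0Φ +φ≃ ≃-trans (+Φ-cong (ΦRing.zeroˡ 1Φ) (*Φ-zeroʳ 1Φ)) (+Φ-identityˡ 0Φ)
  φ-square (suc e) = ≃-trans (≃-sym (*-homo liftHom (φ e) (φ e))) (apply-cong liftHom (φ-square e))

  SquareZero : ∀ {m n} → (Fin m → Φ n) → Set (c ⊔ ℓ)
  SquareZero g = ∀ e → (g e *Φ g e) ≃ 0Φ

  -- The substitution φ_e ↦ g e; it is multiplicative when every g e squares to zero.
  substitute : ∀ {m n} → (Fin m → Φ n) → Φ m → Φ n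
  substitute g ⟨ x ⟩    = x ·Φ 1Φ
  substitute g (a +φ b) = substitute (g ∘ suc) a +Φ (substitute (g ∘ suc) b *Φ g zero)

  substitute-cong : ∀ {m n} (g : Fin m → Φ n) {x y} → x ≃ y → substitute g x ≃ substitute g y
  substitute-cong g (base p)  = ·Φ-congˡ 1Φ p
  substitute-cong g (p +φ≃ q) = +Φ-cong (substitute-cong _ p) (*Φ-cong (substitute-cong _ q) ≃-refl)

  substitute-ext : ∀ {m n} {g g' : Fin m → Φ n} → (∀ e → g e ≃ g' e) → ∀ x → substitute g x ≃ substitute g' x
  substitute-ext g≃g' ⟨ x ⟩    = ≃-refl
  substitute-ext g≃g' (a +φ b) =
    +Φ-cong (substitute-ext (g≃g' ∘ suc) a) (*Φ-cong (substitute-ext (g≃g' ∘ suc) b) (g≃g' zero))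

  substitute-+ : ∀ {m n} (g : Fin m → Φ n) x y → substitute g (x +Φ y) ≃ (substitute g x +Φ substitute g y)
  substitute-+ g ⟨ x ⟩    ⟨ y ⟩      = ·Φ-distribʳ x y 1Φ
  substitute-+ g (a +φ b) (a' +φ b') =
    ≃-trans (+Φ-cong (substitute-+ _ a a') (≃-trans (*Φ-cong (substitute-+ _ b b') ≃-refl) (*Φ-distribʳ _ _ _)))
            (+Φ-interchange _ _ _ _)

  substitute-· : ∀ {m n} (g : Fin m → Φ n) k x → substitute g (k ·Φ x) ≃ (k ·Φ substitute g x)
  substitute-· g k ⟨ x ⟩    = ≃-sym (·Φ-assoc k x 1Φ)
  substitute-· g k (a +φ b) =
    ≃-trans (+Φ-cong (substitute-· _ k a) (≃-trans (*Φ-cong (substitute-· _ k b) ≃-refl) (≃-sym (·Φ-*Φ k _ _))))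
            (≃-sym (·Φ-distribˡ k _ _))

  substitute-0 : ∀ {m n} (g : Fin m → Φ n) → substitute g 0Φ ≃ 0Φ
  substitute-0 {zero}  g = ·Φ-zeroˡ 1Φ
  substitute-0 {suc m} g =
    ≃-trans (+Φ-cong (substitute-0 (g ∘ suc)) (≃-trans (*Φ-cong (substitute-0 (g ∘ suc)) ≃-refl) (ΦRing.zeroˡ _)))
            (+Φ-identityˡ 0Φ)

  substitute-1 : ∀ {m n} (g : Fin m → Φ n) → substitute g 1Φ ≃ 1Φ
  substitute-1 {zero}  g = ·Φ-identity 1Φ
  substitute-1 {suc m} g =
    ≃-trans (+Φ-cong (substitute-1 (g ∘ suc)) (≃-trans (*Φ-cong (substitute-0 (g ∘ suc)) ≃-refl) (ΦRing.zeroˡ _)))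
            (+Φ-identityʳ 1Φ)

  substitute-* : ∀ {m n} (g : Fin m → Φ n) → SquareZero g →
                 ∀ x y → substitute g (x *Φ y) ≃ (substitute g x *Φ substitute g y)
  substitute-* g g²≃0 ⟨ x ⟩ ⟨ y ⟩ = begin
    (x * y) ·Φ 1Φ              ≈⟨ ≃-sym (·Φ-assoc x y 1Φ) ⟩
    x ·Φ (y ·Φ 1Φ)             ≈⟨ ·Φ-cong refl (≃-sym (*Φ-identityˡ _)) ⟩
    x ·Φ (1Φ *Φ (y ·Φ 1Φ))     ≈⟨ ·Φ-*Φ x 1Φ (y ·Φ 1Φ) ⟩
    (x ·Φ 1Φ) *Φ (y ·Φ 1Φ)     ∎
    where open ≃-Reasoning
  substitute-* {n = n} g g²≃0 (a +φ b) (a' +φ b') = begin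
    ψ (a *Φ a') +Φ (ψ ((a *Φ b') +Φ (b *Φ a')) *Φ p)
      ≈⟨ +Φ-cong (substitute-* g' (g²≃0 ∘ suc) a a')
                 (*Φ-cong (≃-trans (substitute-+ g' (a *Φ b') (b *Φ a')) (+Φ-cong (substitute-* g' (g²≃0 ∘ suc) a b')
                                                                  (substitute-* g' (g²≃0 ∘ suc) b a'))) ≃-refl) ⟩
    (ψ a *Φ ψ a') +Φ (((ψ a *Φ ψ b') +Φ (ψ b *Φ ψ a')) *Φ p)
      ≈⟨ ≃-sym (+Φ-identityʳ _) ⟩
    ((ψ a *Φ ψ a') +Φ (((ψ a *Φ ψ b') +Φ (ψ b *Φ ψ a')) *Φ p)) +Φ 0Φ
      ≈⟨ +Φ-cong ≃-refl (≃-sym (≃-trans (*Φ-cong ≃-refl (g²≃0 zero)) (*Φ-zeroʳ _))) ⟩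
    ((ψ a *Φ ψ a') +Φ (((ψ a *Φ ψ b') +Φ (ψ b *Φ ψ a')) *Φ p)) +Φ ((ψ b *Φ ψ b') *Φ (p *Φ p))
      ≈⟨ expand (ψ a) (ψ b) (ψ a') (ψ b') p ⟩
    (ψ a +Φ (ψ b *Φ p)) *Φ (ψ a' +Φ (ψ b' *Φ p)) ∎
    where
    open ≃-Reasoning
    g' = g ∘ suc
    ψ = substitute g'
    p = g zero
    open ΦSolver n
    expand : ∀ A B A' B' p →
      (((A *Φ A') +Φ (((A *Φ B') +Φ (B *Φ A')) *Φ p)) +Φ ((B *Φ B') *Φ (p *Φ p)))
        ≃ ((A +Φ (B *Φ p)) *Φ (A' +Φ (B' *Φ p)))
    expand = solve 5 (λ A B A' B' p →
      ((A :* A') :+ (((A :* B') :+ (B :* A')) :* p)) :+ ((B :* B') :* (p :* p))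
        := (A :+ (B :* p)) :* (A' :+ (B' :* p))) ≃-refl

  substitutionHom : ∀ {m n} (g : Fin m → Φ n) → SquareZero g → AlgHom m n
  substitutionHom g g²≃0 = record
    { apply = substitute g ; apply-cong = substitute-cong g ; +-homo = substitute-+ g
    ; *-homo = substitute-* g g²≃0 ; ·-homo = substitute-· g ; 1-homo = substitute-1 g }

  substitute-φ : ∀ {m n} (g : Fin m → Φ n) e → substitute g (φ e) ≃ g e
  substitute-φ g zero    =
    ≃-trans (+Φ-cong (substitute-0 (g ∘ suc)) (≃-trans (*Φ-cong (substitute-1 (g ∘ suc)) ≃-refl) (*Φ-identityˡ _)))
            (+Φ-identityˡ _)
  substitute-φ g (suc e) =
    ≃-trans (+Φ-cong (substitute-φ (g ∘ suc) e) (≃-trans (*Φ-cong (substitute-0 (g ∘ suc)) ≃-refl) (ΦRing.zeroˡ _)))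
            (+Φ-identityʳ _)

  apply-substitute : ∀ {m n p} (H : AlgHom n p) (g : Fin m → Φ n) x →
                     apply H (substitute g x) ≃ substitute (apply H ∘ g) x
  apply-substitute H g ⟨ x ⟩    = ≃-trans (·-homo H x 1Φ) (·Φ-cong refl (1-homo H))
  apply-substitute H g (a +φ b) =
    ≃-trans (+-homo H _ _) (+Φ-cong (apply-substitute H _ a)
            (≃-trans (*-homo H _ _) (*Φ-cong (apply-substitute H _ b) ≃-refl)))

  substitute-φ-identity : ∀ {m} (x : Φ m) → substitute φ x ≃ x
  substitute-φ-identity ⟨ x ⟩    = base (*-identityʳ x)
  substitute-φ-identity (a +φ b) =
    ≃-trans (+Φ-cong (lifted a) (*Φ-cong (lifted b) ≃-refl))
            (≃-trans (+Φ-cong ≃-refl (*Φ-zeroʳ b)) (+Φ-identityʳ a)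
              +φ≃ ≃-trans (+Φ-identityˡ _) (≃-trans (+Φ-cong (*Φ-identityʳ b) (*Φ-zeroʳ 0Φ)) (+Φ-identityʳ b)))
    where
    lifted : ∀ x → substitute (φ ∘ suc) x ≃ apply liftHom x
    lifted x = ≃-trans (≃-sym (apply-substitute liftHom φ x)) (apply-cong liftHom (substitute-φ-identity x))

  homs-agree-on-φ : ∀ {m n} (H K : AlgHom m n) → (∀ e → apply H (φ e) ≃ apply K (φ e)) →
                    ∀ x → apply H x ≃ apply K x
  homs-agree-on-φ H K H≃K x = begin
    apply H x                      ≈⟨ apply-cong H (≃-sym (substitute-φ-identity x)) ⟩
    apply H (substitute φ x)       ≈⟨ apply-substitute H φ x ⟩
    substitute (apply H ∘ φ) x     ≈⟨ substitute-ext H≃K x ⟩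
    substitute (apply K ∘ φ) x     ≈⟨ apply-substitute K φ x ⟨
    apply K (substitute φ x)       ≈⟨ apply-cong K (substitute-φ-identity x) ⟩
    apply K x                      ∎
    where open ≃-Reasoning

  relabel : ∀ {m n} (τ : Fin m → Fin n) (t : Fin m → Carrier) → AlgHom m n
  relabel τ t = substitutionHom (λ e → t e ·Φ φ (τ e)) scaled-square
    where
    scaled-square : SquareZero (λ e → t e ·Φ φ (τ e))
    scaled-square e = ≃-trans (≃-sym (·Φ-*Φ (t e) _ _))
                     (≃-trans (·Φ-cong refl (ΦRing.*-comm _ _))
                     (≃-trans (·Φ-cong refl (≃-sym (·Φ-*Φ (t e) _ _)))
                     (≃-trans (·Φ-cong refl (·Φ-cong refl (φ-square (τ e))))
                     (≃-trans (·Φ-cong refl (·Φ-zeroʳ (t e))) (·Φ-zeroʳ (t e))))))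

  relabel-φ : ∀ {m n} (τ : Fin m → Fin n) t e → apply (relabel τ t) (φ e) ≃ (t e ·Φ φ (τ e))
  relabel-φ τ t = substitute-φ _

  relabel-inverse : ∀ {m n} (τ : Fin m → Fin n) (τ' : Fin n → Fin m) t t' →
    (∀ e → τ' (τ e) ≡ e) → (∀ e → (t e * t' (τ e)) ≈ 1#) →
    ∀ x → apply (relabel τ' t') (apply (relabel τ t) x) ≃ x
  relabel-inverse τ τ' t t' τ'∘τ tt'≈1 = homs-agree-on-φ (relabel τ' t' ∘Hom relabel τ t) idHom on-φ
    where
    on-φ : ∀ e → apply (relabel τ' t') (apply (relabel τ t) (φ e)) ≃ φ e
    on-φ e = begin
      apply (relabel τ' t') (apply (relabel τ t) (φ e))   ≈⟨ apply-cong (relabel τ' t') (relabel-φ τ t e) ⟩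
      apply (relabel τ' t') (t e ·Φ φ (τ e))               ≈⟨ ·-homo (relabel τ' t') (t e) (φ (τ e)) ⟩
      t e ·Φ apply (relabel τ' t') (φ (τ e))               ≈⟨ ·Φ-cong refl (relabel-φ τ' t' (τ e)) ⟩
      t e ·Φ (t' (τ e) ·Φ φ (τ' (τ e)))                    ≈⟨ ·Φ-assoc _ _ _ ⟩
      (t e * t' (τ e)) ·Φ φ (τ' (τ e))                     ≈⟨ ·Φ-cong (tt'≈1 e) (≃-reflexive (≡.cong φ (τ'∘τ e))) ⟩
      1# ·Φ φ e                                            ≈⟨ ·Φ-identity (φ e) ⟩
      φ e                                                  ∎
      where open ≃-Reasoning

  record _≅Φ_ (m n : ℕ) : Set (c ⊔ ℓ) where
    field
      to      : AlgHom m n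
      from    : AlgHom n m
      from∘to : ∀ x → apply from (apply to x) ≃ x
      to∘from : ∀ y → apply to (apply from y) ≃ y

  open _≅Φ_ public

  ≅Φ-refl : ∀ {m} → m ≅Φ m
  ≅Φ-refl = record { to = idHom ; from = idHom ; from∘to = λ _ → ≃-refl ; to∘from = λ _ → ≃-refl }

  ≅Φ-sym : ∀ {m n} → m ≅Φ n → n ≅Φ m
  ≅Φ-sym I = record { to = from I ; from = to I ; from∘to = to∘from I ; to∘from = from∘to I }

  ≅Φ-trans : ∀ {m n p} → m ≅Φ n → n ≅Φ p → m ≅Φ p
  ≅Φ-trans I J = record
    { to      = to J ∘Hom to I
    ; from    = from I ∘Hom from J
    ; from∘to = λ x → ≃-trans (apply-cong (from I) (from∘to J _)) (from∘to I x)
    ; to∘from = λ y → ≃-trans (apply-cong (to J) (to∘from I _)) (to∘from J y) }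

  relabelIso : ∀ {m n} (π : Fin m ↔ Fin n) (s : Fin m → Carrier) → (∀ e → (s e * s e) ≈ 1#) → m ≅Φ n
  relabelIso π s s²≈1 = record
    { to      = relabel π.to s
    ; from    = relabel π.from (s ∘ π.from)
    ; from∘to = relabel-inverse π.to π.from s (s ∘ π.from) π.strictlyInverseʳ
                  (λ e → trans (*-cong refl (reflexive (≡.cong s (π.strictlyInverseʳ e)))) (s²≈1 e))
    ; to∘from = relabel-inverse π.from π.to (s ∘ π.from) s π.strictlyInverseˡ (s²≈1 ∘ π.from) }
    where module π = Inverse π

module PhiSums {c ℓ} (F : Field c ℓ) where
  open Field F hiding (zero)
  open Alg F
  open PhiRing F
  open PhiMorphisms F

  module KΣ = FiniteSums +-commutativeMonoid
  module ΦΣ {m : ℕ} = FiniteSums (ΦRing.+-commutativeMonoid {m})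
  open ΦΣ public using (sum)

  sumFin≃sum : ∀ {m r} (f : Fin r → Φ m) → sumFin f ≃ sum f
  sumFin≃sum {r = zero}  f = ≃-refl
  sumFin≃sum {r = suc r} f = +Φ-cong ≃-refl (sumFin≃sum (f ∘ suc))

  sum-additive : ∀ {m n} (h : Φ m → Φ n) → (∀ {x y} → x ≃ y → h x ≃ h y) →
                 (∀ x y → h (x +Φ y) ≃ (h x +Φ h y)) → h 0Φ ≃ 0Φ →
                 ∀ {r} (f : Fin r → Φ m) → h (sum f) ≃ sum (h ∘ f)
  sum-additive h h-cong h-+ h-0 {zero}  f = h-0
  sum-additive h h-cong h-+ h-0 {suc r} f =
    ≃-trans (h-+ _ _) (+Φ-cong ≃-refl (sum-additive h h-cong h-+ h-0 (f ∘ suc)))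

  ·Φ-sum : ∀ {m r} k (f : Fin r → Φ m) → (k ·Φ sum f) ≃ sum (λ i → k ·Φ f i)
  ·Φ-sum k = sum-additive (k ·Φ_) (·Φ-cong refl) (·Φ-distribˡ k) (·Φ-zeroʳ k)

  sum-·Φ : ∀ {m r} (κ : Fin r → Carrier) (x : Φ m) → sum (λ i → κ i ·Φ x) ≃ (KΣ.sum κ ·Φ x)
  sum-·Φ {r = zero}  κ x = ≃-sym (·Φ-zeroˡ x)
  sum-·Φ {r = suc r} κ x = ≃-trans (+Φ-cong ≃-refl (sum-·Φ (κ ∘ suc) x)) (≃-sym (·Φ-distribʳ _ _ x))

  β : Bool → Carrier
  β b = if b then 1# else 0#

  ∑⟨_⟩_ : ∀ {n m} → (Fin n → Bool) → (Fin n → Φ m) → Φ m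
  ∑⟨ P ⟩ Y = sum (λ k → β (P k) ·Φ Y k)

  β·-in : ∀ {m b} (y : Φ m) → b ≡ true → (β b ·Φ y) ≃ y
  β·-in y ≡.refl = ·Φ-identity y

  β·-out : ∀ {m b} (y : Φ m) → ¬ b ≡ true → (β b ·Φ y) ≃ 0Φ
  β·-out {b = true}  y b≢true = contradiction ≡.refl b≢true
  β·-out {b = false} y _      = ·Φ-zeroˡ y

  ∑⟨⟩-single : ∀ {n m} (P : Fin n → Bool) (Y : Fin n → Φ m) a →
               P a ≡ true → (∀ k → P k ≡ true → k ≡ a) → (∑⟨ P ⟩ Y) ≃ Y a
  ∑⟨⟩-single P Y a Pa only-a =
    ≃-trans (ΦΣ.sum-single _ a λ k k≢a → β·-out (Y k) (k≢a ∘ only-a k)) (β·-in (Y a) Pa)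

  ∑⟨⟩-pair : ∀ {n m} (P : Fin n → Bool) (Y : Fin n → Φ m) a b → a ≢ b →
             P a ≡ true → P b ≡ true → (∀ k → P k ≡ true → k ≡ a ⊎ k ≡ b) →
             (∑⟨ P ⟩ Y) ≃ (Y a +Φ Y b)
  ∑⟨⟩-pair P Y a b a≢b Pa Pb only-ab =
    ≃-trans (ΦΣ.sum-pair _ a b a≢b λ k k≢a k≢b → β·-out (Y k) ([ k≢a , k≢b ]′ ∘ only-ab k))
            (+Φ-cong (β·-in (Y a) Pa) (β·-in (Y b) Pb))

  ∑⟨⟩-split : ∀ {n m} (S T : Fin n → Bool) (Y : Fin n → Φ m) → (∀ k → S k ≡ true → T k ≡ true) →
              (∑⟨ T ⟩ Y) ≃ ((∑⟨ S ⟩ Y) +Φ (∑⟨ (λ k → T k ∧ not (S k)) ⟩ Y))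
  ∑⟨⟩-split S T Y S⊆T =
    ≃-trans (ΦΣ.sum-cong-≋ λ k → ≃-trans (·Φ-congˡ (Y k) (β-split (T k) (S k) (S⊆T k))) (·Φ-distribʳ _ _ (Y k)))
            (ΦΣ.∑-distrib-+ (λ k → β (S k) ·Φ Y k) (λ k → β (T k ∧ not (S k)) ·Φ Y k))
    where
    β-split : ∀ t s → (s ≡ true → t ≡ true) → β t ≈ (β s + β (t ∧ not s))
    β-split true  true  _   = sym (+-identityʳ 1#)
    β-split true  false _   = sym (+-identityˡ 1#)
    β-split false true  s⇒t = contradiction (s⇒t ≡.refl) λ ()
    β-split false false _   = sym (+-identityˡ 0#)

  apply-∑⟨⟩ : ∀ {r m n} (H : AlgHom m n) (P : Fin r → Bool) (Y : Fin r → Φ m) →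
              apply H (∑⟨ P ⟩ Y) ≃ (∑⟨ P ⟩ (apply H ∘ Y))
  apply-∑⟨⟩ H P Y = ≃-trans (sum-additive (apply H) (apply-cong H) (+-homo H) (0-homo H) (λ k → β (P k) ·Φ Y k))
                            (ΦΣ.sum-cong-≋ λ k → ·-homo H (β (P k)) (Y k))

module Generation {c ℓ} (F : Field c ℓ) where
  open Field F hiding (zero)
  open Alg F
  open PhiRing F
  open PhiMorphisms F
  open PhiSums F

  infix 4 _∈⟨_⟩
  _∈⟨_⟩ : ∀ {n m} → Φ m → (Fin n → Φ m) → Set (c ⊔ ℓ)
  y ∈⟨ v ⟩ = ∃[ t ] (y ≃ eval v t)

  eval-ext : ∀ {n m} {v w : Fin n → Φ m} → (∀ i → v i ≃ w i) → ∀ t → eval v t ≃ eval w t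
  eval-ext v≃w (var i)   = v≃w i
  eval-ext v≃w (const k) = ≃-refl
  eval-ext v≃w (s ⊕ t)   = +Φ-cong (eval-ext v≃w s) (eval-ext v≃w t)
  eval-ext v≃w (s ⊗ t)   = *Φ-cong (eval-ext v≃w s) (eval-ext v≃w t)

  apply-eval : ∀ {n m p} (H : AlgHom m p) (v : Fin n → Φ m) t → apply H (eval v t) ≃ eval (apply H ∘ v) t
  apply-eval H v (var i)   = ≃-refl
  apply-eval H v (const k) = ≃-trans (·-homo H k 1Φ) (·Φ-cong refl (1-homo H))
  apply-eval H v (s ⊕ t)   = ≃-trans (+-homo H _ _) (+Φ-cong (apply-eval H v s) (apply-eval H v t))
  apply-eval H v (s ⊗ t)   = ≃-trans (*-homo H _ _) (*Φ-cong (apply-eval H v s) (apply-eval H v t))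

  substTerm : ∀ {n n'} → (Fin n → Term n') → Term n → Term n'
  substTerm s (var i)   = s i
  substTerm s (const k) = const k
  substTerm s (a ⊕ b)   = substTerm s a ⊕ substTerm s b
  substTerm s (a ⊗ b)   = substTerm s a ⊗ substTerm s b

  eval-substTerm : ∀ {n n' m} (w : Fin n' → Φ m) (s : Fin n → Term n') t →
                   eval w (substTerm s t) ≃ eval (eval w ∘ s) t
  eval-substTerm w s (var i)   = ≃-refl
  eval-substTerm w s (const k) = ≃-refl
  eval-substTerm w s (a ⊕ b)   = +Φ-cong (eval-substTerm w s a) (eval-substTerm w s b)
  eval-substTerm w s (a ⊗ b)   = *Φ-cong (eval-substTerm w s a) (eval-substTerm w s b)

  module _ {n m : ℕ} {v : Fin n → Φ m} where
    ∈⟨⟩-resp : ∀ {x y} → x ≃ y → y ∈⟨ v ⟩ → x ∈⟨ v ⟩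
    ∈⟨⟩-resp x≃y (t , y≃t) = t , ≃-trans x≃y y≃t

    ∈⟨⟩-generator : ∀ i → v i ∈⟨ v ⟩
    ∈⟨⟩-generator i = var i , ≃-refl

    ∈⟨⟩-0 : 0Φ ∈⟨ v ⟩
    ∈⟨⟩-0 = const 0# , ≃-sym (·Φ-zeroˡ 1Φ)

    ∈⟨⟩-+ : ∀ {x y} → x ∈⟨ v ⟩ → y ∈⟨ v ⟩ → (x +Φ y) ∈⟨ v ⟩
    ∈⟨⟩-+ (s , x≃s) (t , y≃t) = s ⊕ t , +Φ-cong x≃s y≃t

    ∈⟨⟩-· : ∀ k {x} → x ∈⟨ v ⟩ → (k ·Φ x) ∈⟨ v ⟩
    ∈⟨⟩-· k (t , x≃t) =
      const k ⊗ t , ≃-trans (·Φ-cong refl x≃t) (≃-trans (·Φ-cong refl (≃-sym (*Φ-identityˡ _))) (·Φ-*Φ k 1Φ _))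

    ∈⟨⟩-sum : ∀ {r} (f : Fin r → Φ m) → (∀ i → f i ∈⟨ v ⟩) → sum f ∈⟨ v ⟩
    ∈⟨⟩-sum {zero}  f f∈ = ∈⟨⟩-0
    ∈⟨⟩-sum {suc r} f f∈ = ∈⟨⟩-+ (f∈ zero) (∈⟨⟩-sum (f ∘ suc) (f∈ ∘ suc))

    ∈⟨⟩-difference : ∀ {x y} → x ∈⟨ v ⟩ → y ∈⟨ v ⟩ → (x +Φ (-Φ y)) ∈⟨ v ⟩
    ∈⟨⟩-difference x∈ y∈ = ∈⟨⟩-+ x∈ (∈⟨⟩-· (- 1#) y∈)

    ∈⟨⟩-cancel : ∀ {x y} → (x +Φ y) ∈⟨ v ⟩ → y ∈⟨ v ⟩ → x ∈⟨ v ⟩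
    ∈⟨⟩-cancel {x} {y} x+y∈ y∈ = ∈⟨⟩-resp x≃x+y-y (∈⟨⟩-difference x+y∈ y∈)
      where
      x≃x+y-y : x ≃ ((x +Φ y) +Φ (-Φ y))
      x≃x+y-y = ≃-sym (≃-trans (+Φ-assoc x y (-Φ y)) (≃-trans (+Φ-cong ≃-refl (-Φ-inverseʳ y)) (+Φ-identityʳ x)))

    ∈⟨⟩-∑⟨⟩ : ∀ {r} (P : Fin r → Bool) (Y : Fin r → Φ m) → (∀ k → P k ≡ true → Y k ∈⟨ v ⟩) → (∑⟨ P ⟩ Y) ∈⟨ v ⟩
    ∈⟨⟩-∑⟨⟩ P Y Y∈ = ∈⟨⟩-sum _ term∈
      where
      term∈ : ∀ k → (β (P k) ·Φ Y k) ∈⟨ v ⟩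
      term∈ k with P k in Pk
      ... | true  = ∈⟨⟩-resp (β·-in (Y k) ≡.refl) (Y∈ k Pk)
      ... | false = ∈⟨⟩-resp (β·-out {b = false} (Y k) λ ()) ∈⟨⟩-0

  ∈⟨⟩-eval : ∀ {n n' m} {v : Fin n → Φ m} {w : Fin n' → Φ m} → (∀ i → v i ∈⟨ w ⟩) → ∀ t → eval v t ∈⟨ w ⟩
  ∈⟨⟩-eval v∈ t = substTerm (proj₁ ∘ v∈) t , ≃-trans (eval-ext (proj₂ ∘ v∈) t) (≃-sym (eval-substTerm _ _ t))

  ∈⟨⟩-trans : ∀ {n n' m} {v : Fin n → Φ m} {w : Fin n' → Φ m} {x} → (∀ i → v i ∈⟨ w ⟩) → x ∈⟨ v ⟩ → x ∈⟨ w ⟩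
  ∈⟨⟩-trans v∈ (t , x≃t) = ∈⟨⟩-resp x≃t (∈⟨⟩-eval v∈ t)

  apply-∈⟨⟩ : ∀ {n m p} (H : AlgHom m p) {v : Fin n → Φ m} {x} → x ∈⟨ v ⟩ → apply H x ∈⟨ apply H ∘ v ⟩
  apply-∈⟨⟩ H {v} (t , x≃t) = t , ≃-trans (apply-cong H x≃t) (apply-eval H v t)

module Linking {c ℓ} (F : Field c ℓ) where
  open Field F hiding (zero)
  open Alg F
  open PhiRing F
  open PhiMorphisms F
  open Generation F

  InC⇒∈⟨X⟩ : ∀ G {x} → InC G x → x ∈⟨ X G ⟩
  InC⇒∈⟨X⟩ G (t , x≈t) = t , ≈Φ⇒≃ x≈t

  SameSpan : ∀ {n n' m} → (Fin n → Φ m) → (Fin n' → Φ m) → Set (c ⊔ ℓ)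
  SameSpan v w = (∀ i → v i ∈⟨ w ⟩) × (∀ j → w j ∈⟨ v ⟩)

  SameSpan-resp : ∀ {n n' m} {v v' : Fin n → Φ m} {w w' : Fin n' → Φ m} →
    (∀ i → v i ≃ v' i) → (∀ j → w j ≃ w' j) → SameSpan v' w' → SameSpan v w
  SameSpan-resp v≃v' w≃w' (v'⊆w' , w'⊆v') =
      (λ i → ∈⟨⟩-resp (v≃v' i) (∈⟨⟩-trans (λ j → ∈⟨⟩-resp (≃-sym (w≃w' j)) (∈⟨⟩-generator j)) (v'⊆w' i)))
    , (λ j → ∈⟨⟩-resp (w≃w' j) (∈⟨⟩-trans (λ i → ∈⟨⟩-resp (≃-sym (v≃v' i)) (∈⟨⟩-generator i)) (w'⊆v' j)))

  -- C_G and C_H become the same subalgebra after embedding Φ_G and Φ_H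
  -- isomorphically into a common Φ_k.
  record Linked (G H : Graph) : Set (c ⊔ ℓ) where
    field
      {k}   : ℕ
      χ     : nE G ≅Φ k
      χ'    : nE H ≅Φ k
      spans : SameSpan (apply (to χ) ∘ X G) (apply (to χ') ∘ X H)

  Linked-refl : ∀ G → Linked G G
  Linked-refl G = record { χ = ≅Φ-refl ; χ' = ≅Φ-refl ; spans = ∈⟨⟩-generator , ∈⟨⟩-generator }

  Linked-sym : ∀ {G H} → Linked G H → Linked H G
  Linked-sym L = record { χ = χ' ; χ' = χ ; spans = proj₂ spans , proj₁ spans }
    where open Linked L

  pull-∈⟨⟩ : ∀ {n m p} (I : m ≅Φ p) {v : Fin n → Φ m} {y} → y ∈⟨ apply (to I) ∘ v ⟩ → apply (from I) y ∈⟨ v ⟩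
  pull-∈⟨⟩ I y∈ = ∈⟨⟩-trans (λ i → ∈⟨⟩-resp (from∘to I _) (∈⟨⟩-generator i)) (apply-∈⟨⟩ (from I) y∈)

  ∈⟨X⟩⇒InC : ∀ G {x} → x ∈⟨ X G ⟩ → InC G x
  ∈⟨X⟩⇒InC G (t , x≃t) = t , ≃⇒≈Φ x≃t

  Linked⇒AlgIso : ∀ {G H} → Linked G H → AlgIso G H
  Linked⇒AlgIso {G} {H} L = record
    { f      = λ x → apply T (proj₁ x)
    ; closed = λ x → ∈⟨X⟩⇒InC H (T-∈⟨X⟩ (InC⇒∈⟨X⟩ G (proj₂ x)))
    ; resp   = λ x y x≈y → ≃⇒≈Φ (apply-cong T (≈Φ⇒≃ x≈y))
    ; inj    = λ x y Tx≈Ty → ≃⇒≈Φ (≃-trans (≃-sym (T⁻¹∘T _)) (≃-trans (apply-cong T⁻¹ (≈Φ⇒≃ Tx≈Ty)) (T⁻¹∘T _)))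
    ; surj   = λ y y∈ → (apply T⁻¹ y , ∈⟨X⟩⇒InC G (T⁻¹-∈⟨X⟩ (InC⇒∈⟨X⟩ H y∈))) , ≃⇒≈Φ (T∘T⁻¹ y)
    ; pres-+ = λ x y z x+y≈z → ≃⇒≈Φ (≃-trans (apply-cong T (≃-sym (≈Φ⇒≃ x+y≈z))) (+-homo T _ _))
    ; pres-* = λ x y z x*y≈z → ≃⇒≈Φ (≃-trans (apply-cong T (≃-sym (≈Φ⇒≃ x*y≈z))) (*-homo T _ _))
    ; pres-· = λ k x z k·x≈z → ≃⇒≈Φ (≃-trans (apply-cong T (≃-sym (≈Φ⇒≃ k·x≈z))) (·-homo T k _))
    ; pres-1 = λ x x≈1 → ≃⇒≈Φ (≃-trans (apply-cong T (≈Φ⇒≃ x≈1)) (1-homo T))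
    }
    where
    open Linked L
    T : AlgHom (nE G) (nE H)
    T = from χ' ∘Hom to χ
    T⁻¹ : AlgHom (nE H) (nE G)
    T⁻¹ = from χ ∘Hom to χ'
    T⁻¹∘T : ∀ x → apply T⁻¹ (apply T x) ≃ x
    T⁻¹∘T x = ≃-trans (apply-cong (from χ) (to∘from χ' _)) (from∘to χ x)
    T∘T⁻¹ : ∀ y → apply T (apply T⁻¹ y) ≃ y
    T∘T⁻¹ y = ≃-trans (apply-cong (from χ') (to∘from χ _)) (from∘to χ' y)
    T-∈⟨X⟩ : ∀ {x} → x ∈⟨ X G ⟩ → apply T x ∈⟨ X H ⟩
    T-∈⟨X⟩ x∈ = pull-∈⟨⟩ χ' (∈⟨⟩-trans (proj₁ spans) (apply-∈⟨⟩ (to χ) x∈))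
    T⁻¹-∈⟨X⟩ : ∀ {y} → y ∈⟨ X H ⟩ → apply T⁻¹ y ∈⟨ X G ⟩
    T⁻¹-∈⟨X⟩ y∈ = pull-∈⟨⟩ χ (∈⟨⟩-trans (proj₂ spans) (apply-∈⟨⟩ (to χ') y∈))

  AlgIso-trans : ∀ {G H K} → AlgIso G H → AlgIso H K → AlgIso G K
  AlgIso-trans {G} {H} {K} I J = record
    { f      = f'
    ; closed = λ x → J.closed _
    ; resp   = λ x y x≈y → J.resp _ _ (I.resp x y x≈y)
    ; inj    = λ x y f'x≈f'y → I.inj x y (J.inj _ _ f'x≈f'y)
    ; surj   = surj
    ; pres-+ = λ x y z p → J.pres-+ _ _ _ (≈Φ-sym (I.f z) (I.pres-+ x y z p))
    ; pres-* = λ x y z p → J.pres-* _ _ _ (≈Φ-sym (I.f z) (I.pres-* x y z p))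
    ; pres-· = λ k x z p → J.pres-· _ _ _ (≈Φ-sym (I.f z) (I.pres-· k x z p))
    ; pres-1 = λ x p → J.pres-1 _ (I.pres-1 x p)
    }
    where
    module I = AlgIso I
    module J = AlgIso J
    f' : C G → Φ (nE K)
    f' x = J.f (I.f x , I.closed x)
    ≈Φ-sym : ∀ x {y} → x ≈Φ y → y ≈Φ x
    ≈Φ-sym x {y} x≈y = ≃⇒≈Φ (≃-sym (≈Φ⇒≃ {x = x} {y} x≈y))
    surj : ∀ z → InC K z → ∃[ x ] (f' x ≈Φ z)
    surj z z∈ with J.surj z z∈
    ... | (y , y∈) , Jy≈z with I.surj y y∈
    ... | x , Ix≈y = x , ≃⇒≈Φ (≃-trans (≈Φ⇒≃ {x = f' x} (J.resp (I.f x , I.closed x) (y , y∈) Ix≈y)) (≈Φ⇒≃ Jy≈z))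

module Incidence {c ℓ} (F : Field c ℓ) where
  open Field F hiding (zero)
  open Alg F
  open import Algebra.Properties.Ring ring using (-‿involutive; -‿distribˡ-*; -‿distribʳ-*; -0#≈0#)
  open PhiRing F
  open PhiMorphisms F
  open PhiSums F

  sign : Bool → Carrier
  sign b = if b then 1# else - 1#

  sign-square : ∀ b → (sign b * sign b) ≈ 1#
  sign-square true  = *-identityˡ 1#
  sign-square false = trans (sym (-‿distribˡ-* 1# (- 1#))) (trans (-‿cong (*-identityˡ (- 1#))) (-‿involutive 1#))

  orientation : ∀ {n} → Fin n → Fin n → Carrier
  orientation a b = sign (does (a <? b))

  orientation-antisym : ∀ {n} (a b : Fin n) → a ≢ b → orientation b a ≈ - orientation a b
  orientation-antisym a b a≢b with <-cmp a b
  ... | tri< a<b _ _ rewrite dec-false (b <? a) (<-asym a<b) | dec-true (a <? b) a<b = refl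
  ... | tri≈ _ a≡b _ = contradiction a≡b a≢b
  ... | tri> _ _ b<a rewrite dec-true (b <? a) b<a | dec-false (a <? b) (<-asym b<a) = sym (-‿involutive 1#)

  incidence : ∀ {n} → Fin n → Fin n → Fin n → Carrier
  incidence i a b = if does (i ≟ a) then orientation a b else (if does (i ≟ b) then orientation b a else 0#)

  coeff≡incidence : ∀ G i e → coeff G i e ≡ incidence i (proj₁ (ends G e)) (proj₂ (ends G e))
  coeff≡incidence G i e with ends G e
  ... | (a , b) = ≡.refl

  incidence-source : ∀ {n} (a b : Fin n) → incidence a a b ≡ orientation a b
  incidence-source a b rewrite dec-true (a ≟ a) ≡.refl = ≡.refl

  incidence-target : ∀ {n} (a b : Fin n) → a ≢ b → incidence b a b ≡ orientation b a
  incidence-target a b a≢b rewrite dec-false (b ≟ a) (a≢b ∘ ≡.sym) | dec-true (b ≟ b) ≡.refl = ≡.refl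

  incidence-other : ∀ {n} (i a b : Fin n) → i ≢ a → i ≢ b → incidence i a b ≡ 0#
  incidence-other i a b i≢a i≢b rewrite dec-false (i ≟ a) i≢a | dec-false (i ≟ b) i≢b = ≡.refl

  record EdgeColumn (G : Graph) (e : Fin (nE G)) (x y : Fin (nV G)) : Set ℓ where
    field
      distinct : x ≢ y
      square   : (coeff G x e * coeff G x e) ≈ 1#
      opposite : coeff G y e ≈ - coeff G x e
      vanish   : ∀ i → i ≢ x → i ≢ y → coeff G i e ≈ 0#

  edgeColumn : ∀ G e {x y} → SamePair (ends G e) (x , y) → EdgeColumn G e x y
  edgeColumn G e {x} {y} (inj₁ (≡.refl , ≡.refl)) = record
    { distinct = loopless G e
    ; square   = trans (reflexive (≡.cong (λ z → z * z) c-x)) (sign-square _)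
    ; opposite = trans (reflexive c-y) (trans (orientation-antisym x y (loopless G e)) (-‿cong (reflexive (≡.sym c-x))))
    ; vanish   = λ i i≢x i≢y → reflexive (≡.trans (coeff≡incidence G i e) (incidence-other i x y i≢x i≢y)) }
    where
    c-x = ≡.trans (coeff≡incidence G x e) (incidence-source x y)
    c-y = ≡.trans (coeff≡incidence G y e) (incidence-target x y (loopless G e))
  edgeColumn G e {x} {y} (inj₂ (≡.refl , ≡.refl)) = record
    { distinct = loopless G e ∘ ≡.sym
    ; square   = trans (reflexive (≡.cong (λ z → z * z) c-x)) (sign-square _)
    ; opposite = trans (reflexive c-y)
                       (trans (orientation-antisym x y (loopless G e ∘ ≡.sym)) (-‿cong (reflexive (≡.sym c-x))))
    ; vanish   = λ i i≢x i≢y → reflexive (≡.trans (coeff≡incidence G i e) (incidence-other i y x i≢y i≢x)) }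
    where
    c-x = ≡.trans (coeff≡incidence G x e) (incidence-target y x (loopless G e))
    c-y = ≡.trans (coeff≡incidence G y e) (incidence-source y x)

  module _ (G : Graph) (e : Fin (nE G)) {x y} (x~y : SamePair (ends G e) (x , y)) where
    open EdgeColumn (edgeColumn G e x~y)

    column-product : ∀ j → (coeff G j e * coeff G x e) ≈ (β (x ≡ᵇ j) + - β (y ≡ᵇ j))
    column-product j with j ≟ x | j ≟ y
    ... | yes ≡.refl | _ rewrite dec-true (j ≟ j) ≡.refl | dec-false (y ≟ j) (distinct ∘ ≡.sym) =
      trans square (sym (trans (+-cong refl -0#≈0#) (+-identityʳ 1#)))
    ... | no j≢x | yes ≡.refl rewrite dec-false (x ≟ j) (j≢x ∘ ≡.sym) | dec-true (j ≟ j) ≡.refl =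
      trans (*-cong opposite refl) (trans (sym (-‿distribˡ-* _ _)) (trans (-‿cong square) (sym (+-identityˡ _))))
    ... | no j≢x | no j≢y rewrite dec-false (x ≟ j) (j≢x ∘ ≡.sym) | dec-false (y ≟ j) (j≢y ∘ ≡.sym) =
      trans (*-cong (vanish j j≢x j≢y) refl) (trans (zeroˡ _) (sym (trans (+-cong refl -0#≈0#) (+-identityʳ 0#))))

  X≃sum : ∀ G k → X G k ≃ sum (λ e → coeff G k e ·Φ φ e)
  X≃sum G k = sumFin≃sum (λ e → coeff G k e ·Φ φ e)

  apply-X : ∀ {n} G (H : AlgHom (nE G) n) k → apply H (X G k) ≃ sum (λ e → coeff G k e ·Φ apply H (φ e))
  apply-X G H k = ≃-trans (apply-cong H (X≃sum G k))
                 (≃-trans (sum-additive (apply H) (apply-cong H) (+-homo H) (0-homo H) (λ e → coeff G k e ·Φ φ e))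
                          (ΦΣ.sum-cong-≋ λ e → ·-homo H (coeff G k e) (φ e)))

  X-combination : ∀ G (κ : Fin (nV G) → Carrier) →
    sum (λ i → κ i ·Φ X G i) ≃ sum (λ e → KΣ.sum (λ i → κ i * coeff G i e) ·Φ φ e)
  X-combination G κ = begin
    sum (λ i → κ i ·Φ X G i)                              ≈⟨ ΦΣ.sum-cong-≋ (λ i → ·Φ-cong refl (X≃sum G i)) ⟩
    sum (λ i → κ i ·Φ sum (λ e → coeff G i e ·Φ φ e))     ≈⟨ ΦΣ.sum-cong-≋ (λ i → ·Φ-sum (κ i) (λ e → coeff G i e ·Φ φ e)) ⟩
    sum (λ i → sum (λ e → κ i ·Φ (coeff G i e ·Φ φ e)))
      ≈⟨ ΦΣ.sum-cong-≋ (λ i → ΦΣ.sum-cong-≋ λ e → ·Φ-assoc (κ i) (coeff G i e) (φ e)) ⟩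
    sum (λ i → sum (λ e → (κ i * coeff G i e) ·Φ φ e))    ≈⟨ ΦΣ.∑-comm (λ i e → (κ i * coeff G i e) ·Φ φ e) ⟩
    sum (λ e → sum (λ i → (κ i * coeff G i e) ·Φ φ e))    ≈⟨ ΦΣ.sum-cong-≋ (λ e → sum-·Φ (λ i → κ i * coeff G i e) (φ e)) ⟩
    sum (λ e → KΣ.sum (λ i → κ i * coeff G i e) ·Φ φ e)   ∎
    where open ≃-Reasoning

  column-sum : ∀ G e {x y} → SamePair (ends G e) (x , y) → (κ : Fin (nV G) → Carrier) →
               KΣ.sum (λ i → κ i * coeff G i e) ≈ ((κ x * coeff G x e) + (κ y * coeff G y e))
  column-sum G e x~y κ = KΣ.sum-pair _ _ _ distinct λ i i≢x i≢y → trans (*-cong refl (vanish i i≢x i≢y)) (zeroʳ _)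
    where open EdgeColumn (edgeColumn G e x~y)

  -- Each φ_e enters twice, with opposite signs, at its two endpoints, which T contains both or neither of.
  ∑⟨closed⟩≃0 : ∀ G {T} → EdgeClosed G T → (∑⟨ T ⟩ X G) ≃ 0Φ
  ∑⟨closed⟩≃0 G {T} closed =
    ≃-trans (X-combination G (β ∘ T))
            (ΦΣ.sum-vanishing _ λ e → ≃-trans (·Φ-congˡ (φ e) (column-vanishes e)) (·Φ-zeroˡ (φ e)))
    where
    column-vanishes : ∀ e → KΣ.sum (λ i → β (T i) * coeff G i e) ≈ 0#
    column-vanishes e = begin
      KΣ.sum (λ i → β (T i) * coeff G i e)         ≈⟨ column-sum G e (inj₁ (≡.refl , ≡.refl)) (β ∘ T) ⟩
      (β (T a) * coeff G a e) + (β (T b) * coeff G b e)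
        ≈⟨ +-cong refl (*-cong (reflexive (≡.cong β (≡.sym (closed e)))) opposite) ⟩
      (β (T a) * coeff G a e) + (β (T a) * - coeff G a e) ≈⟨ distribˡ _ _ _ ⟨
      β (T a) * (coeff G a e + - coeff G a e)      ≈⟨ *-cong refl (-‿inverseʳ _) ⟩
      β (T a) * 0#                                 ≈⟨ zeroʳ _ ⟩
      0#                                           ∎
      where
      open import Relation.Binary.Reasoning.Setoid setoid
      a = proj₁ (ends G e)
      b = proj₂ (ends G e)
      open EdgeColumn (edgeColumn G e (inj₁ (≡.refl , ≡.refl)))

module Merges {c ℓ} (F : Field c ℓ) where
  open Field F hiding (zero)
  open Alg F
  open import Algebra.Properties.Ring ring using (-‿distribˡ-*; -‿distribʳ-*)
  open import Algebra.Properties.CommutativeSemigroup *-commutativeSemigroup using (interchange)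
  open PhiRing F
  open PhiMorphisms F
  open PhiSums F
  open Incidence F
  open Generation F
  open Linking F

  module _ {G H : Graph} (M : Merge G H) where
    fibre : Fin (nV H) → Fin (nV G) → Bool
    fibre j i = q M i ≡ᵇ j

    -- the sign relating the orientation of e in G to that of σ e in H
    mergeSign : Fin (nE G) → Carrier
    mergeSign e = coeff H (q M (proj₁ (ends G e))) (Inverse.to (σ M) e) * coeff G (proj₁ (ends G e)) e

    mergeSign-square : ∀ e → (mergeSign e * mergeSign e) ≈ 1#
    mergeSign-square e = trans (interchange _ _ _ _) (trans (*-cong H-square G-square) (*-identityˡ 1#))
      where
      H-square = EdgeColumn.square (edgeColumn H _ (compat M e))
      G-square = EdgeColumn.square (edgeColumn G e (inj₁ (≡.refl , ≡.refl)))

    mergeSign-column : ∀ j e → (coeff H j (Inverse.to (σ M) e) * mergeSign e) ≈ KΣ.sum (λ i → β (fibre j i) * coeff G i e)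
    mergeSign-column j e = begin
      cH j * (cH a' * cG a)                        ≈⟨ *-assoc _ _ _ ⟨
      (cH j * cH a') * cG a                        ≈⟨ *-cong (column-product H e' (compat M e) j) refl ⟩
      (β (a' ≡ᵇ j) + - β (b' ≡ᵇ j)) * cG a         ≈⟨ distribʳ _ _ _ ⟩
      β (a' ≡ᵇ j) * cG a + (- β (b' ≡ᵇ j)) * cG a  ≈⟨ +-cong refl (trans (sym (-‿distribˡ-* _ _)) (-‿distribʳ-* _ _)) ⟩
      β (a' ≡ᵇ j) * cG a + β (b' ≡ᵇ j) * - cG a    ≈⟨ +-cong refl (*-cong refl (sym opposite)) ⟩
      β (a' ≡ᵇ j) * cG a + β (b' ≡ᵇ j) * cG b      ≈⟨ column-sum G e (inj₁ (≡.refl , ≡.refl)) (λ i → β (fibre j i)) ⟨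
      KΣ.sum (λ i → β (fibre j i) * coeff G i e)  ∎
      where
      open import Relation.Binary.Reasoning.Setoid setoid
      e' = Inverse.to (σ M) e
      a = proj₁ (ends G e)
      b = proj₂ (ends G e)
      a' = q M a
      b' = q M b
      cH = λ k → coeff H k e'
      cG = λ k → coeff G k e
      open EdgeColumn (edgeColumn G e (inj₁ (≡.refl , ≡.refl)))

    mergeIso : nE H ≅Φ nE G
    mergeIso = ≅Φ-sym (relabelIso (σ M) mergeSign mergeSign-square)

    mergeIso-X : ∀ j → apply (to mergeIso) (X H j) ≃ (∑⟨ fibre j ⟩ X G)
    mergeIso-X j = begin
      apply (relabel τ⁻¹ (s ∘ τ⁻¹)) (X H j)
        ≈⟨ apply-X H (relabel τ⁻¹ (s ∘ τ⁻¹)) j ⟩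
      sum (λ e' → coeff H j e' ·Φ apply (relabel τ⁻¹ (s ∘ τ⁻¹)) (φ e'))
        ≈⟨ ΦΣ.sum-cong-≋ (λ e' → ·Φ-cong refl (relabel-φ τ⁻¹ (s ∘ τ⁻¹) e')) ⟩
      sum (λ e' → coeff H j e' ·Φ (s (τ⁻¹ e') ·Φ φ (τ⁻¹ e')))
        ≈⟨ ΦΣ.sum-permute (λ e' → coeff H j e' ·Φ (s (τ⁻¹ e') ·Φ φ (τ⁻¹ e'))) (σ M) ⟩
      sum (λ e → coeff H j (τ e) ·Φ (s (τ⁻¹ (τ e)) ·Φ φ (τ⁻¹ (τ e))))
        ≈⟨ ΦΣ.sum-cong-≋ (λ e → ·Φ-cong refl (≃-reflexive (≡.cong (λ e'' → s e'' ·Φ φ e'') (τ⁻¹∘τ e)))) ⟩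
      sum (λ e → coeff H j (τ e) ·Φ (s e ·Φ φ e))
        ≈⟨ ΦΣ.sum-cong-≋ (λ e → ≃-trans (·Φ-assoc _ _ _) (·Φ-congˡ (φ e) (mergeSign-column j e))) ⟩
      sum (λ e → KΣ.sum (λ i → β (fibre j i) * coeff G i e) ·Φ φ e)
        ≈⟨ X-combination G (λ i → β (fibre j i)) ⟨
      (∑⟨ fibre j ⟩ X G) ∎
      where
      open ≃-Reasoning
      τ = Inverse.to (σ M)
      τ⁻¹ = Inverse.from (σ M)
      τ⁻¹∘τ = Inverse.strictlyInverseʳ (σ M)
      s = mergeSign

    module _ {m} (Y : Fin (nV G) → Φ m) where
      fibre-isolated : ∀ k → Kernels.Isolated M k → (∑⟨ fibre (q M k) ⟩ Y) ≃ Y k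
      fibre-isolated k isolated = ∑⟨⟩-single _ Y k (≡ᵇ-refl (q M k)) (λ i → isolated i ∘ ≡ᵇ⇒≡)

      fibre-pair : ∀ a b → a ≢ b → q M b ≡ q M a → (∀ i → q M i ≡ q M a → i ≡ a ⊎ i ≡ b) →
                   (∑⟨ fibre (q M a) ⟩ Y) ≃ (Y a +Φ Y b)
      fibre-pair a b a≢b glued class =
        ∑⟨⟩-pair _ Y a b a≢b (≡ᵇ-refl (q M a)) (≡.subst (λ z → (z ≡ᵇ q M a) ≡ true) (≡.sym glued) (≡ᵇ-refl (q M a)))
                 (λ i → class i ∘ ≡ᵇ⇒≡)

    Linked-merge : (∀ i → X G i ∈⟨ (λ j → ∑⟨ fibre j ⟩ X G) ⟩) → Linked G H
    Linked-merge X∈ = record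
      { χ = ≅Φ-refl
      ; χ' = mergeIso
      ; spans = (λ i → ∈⟨⟩-trans (λ j → ∈⟨⟩-resp (≃-sym (mergeIso-X j)) (∈⟨⟩-generator j)) (X∈ i))
              , (λ j → ∈⟨⟩-resp (mergeIso-X j) (∈⟨⟩-∑⟨⟩ (fibre j) (X G) (λ k _ → ∈⟨⟩-generator k))) }

    fibres-∈⟨⟩₂ : ∀ {m n} {Y : Fin (nV G) → Φ m} {w : Fin n → Φ m} {a b c d} → KernelIs2 M a b c d →
      a ≢ c → a ≢ d → b ≢ c → a ≢ b → c ≢ d →
      (∀ k → k ≢ a → k ≢ b → k ≢ c → k ≢ d → Y k ∈⟨ w ⟩) → (Y a +Φ Y b) ∈⟨ w ⟩ → (Y c +Φ Y d) ∈⟨ w ⟩ →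
      ∀ j → (∑⟨ fibre j ⟩ Y) ∈⟨ w ⟩
    fibres-∈⟨⟩₂ {Y = Y} {w} {a} {b} {c} {d} K a≢c a≢d b≢c a≢b c≢d outer∈ ab∈ cd∈ j =
      ≡.subst (λ j → (∑⟨ fibre j ⟩ Y) ∈⟨ w ⟩) (proj₂ (q-surj M j)) (classify (proj₁ (q-surj M j)))
      where
      open Kernels M
      fibre-a : (∑⟨ fibre (q M a) ⟩ Y) ∈⟨ w ⟩
      fibre-a = ∈⟨⟩-resp (fibre-pair Y a b a≢b (glued₂ K) (same-fibre₂ K a≢c a≢d)) ab∈
      fibre-c : (∑⟨ fibre (q M c) ⟩ Y) ∈⟨ w ⟩
      fibre-c = ∈⟨⟩-resp (fibre-pair Y c d c≢d (glued₂ (swap₂ K)) (same-fibre₂ (swap₂ K) (a≢c ∘ ≡.sym) (b≢c ∘ ≡.sym))) cd∈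
      glued-to : ∀ {x y} → q M y ≡ q M x → (∑⟨ fibre (q M x) ⟩ Y) ∈⟨ w ⟩ → (∑⟨ fibre (q M y) ⟩ Y) ∈⟨ w ⟩
      glued-to qy≡qx = ≡.subst (λ j → (∑⟨ fibre j ⟩ Y) ∈⟨ w ⟩) (≡.sym qy≡qx)
      classify : ∀ k → (∑⟨ fibre (q M k) ⟩ Y) ∈⟨ w ⟩
      classify k with k ≟ a | k ≟ b | k ≟ c | k ≟ d
      ... | yes ≡.refl | _          | _          | _          = fibre-a
      ... | no _       | yes ≡.refl | _          | _          = glued-to (glued₂ K) fibre-a
      ... | no _       | no _       | yes ≡.refl | _          = fibre-c
      ... | no _       | no _       | no _       | yes ≡.refl = glued-to (glued₂ (swap₂ K)) fibre-c
      ... | no k≢a     | no k≢b     | no k≢c     | no k≢d     =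
        ∈⟨⟩-resp (fibre-isolated Y k (outside⇒isolated₂ K k≢a k≢b k≢c k≢d)) (outer∈ k k≢a k≢b k≢c k≢d)

module Operations {c ℓ} (F : Field c ℓ) where
  open Field F hiding (zero)
  open Alg F
  open PhiRing F
  open PhiMorphisms F
  open PhiSums F
  open Incidence F
  open Generation F
  open Linking F
  open Merges F

  ∑⟨⟩-∈⟨⟩-complement : ∀ G {n} {w : Fin n → Φ (nE G)} {S T : Fin (nV G) → Bool} → EdgeClosed G T →
    (∀ k → S k ≡ true → T k ≡ true) → (∀ k → T k ≡ true → S k ≡ false → X G k ∈⟨ w ⟩) →
    (∑⟨ S ⟩ X G) ∈⟨ w ⟩
  ∑⟨⟩-∈⟨⟩-complement G {S = S} {T} T-closed S⊆T rest∈ =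
    ∈⟨⟩-resp ∑S≃-∑rest (∈⟨⟩-· (- 1#) (∈⟨⟩-∑⟨⟩ Rest (X G) rest∈'))
    where
    Rest : Fin (nV G) → Bool
    Rest k = T k ∧ not (S k)
    ∑S≃-∑rest : (∑⟨ S ⟩ X G) ≃ (-Φ (∑⟨ Rest ⟩ X G))
    ∑S≃-∑rest = ΦRingProperties.+-inverseˡ-unique _ _ (≃-trans (≃-sym (∑⟨⟩-split S T (X G) S⊆T)) (∑⟨closed⟩≃0 G T-closed))
    rest∈' : ∀ k → Rest k ≡ true → X G k ∈⟨ _ ⟩
    rest∈' k Rest-k with T k in Tk | S k in Sk
    ... | true | false = rest∈ k Tk Sk

  Linked-identification : ∀ {G H} → Identification G H → Linked G H
  Linked-identification {G} {H} (v , v' , v↮v' , M , K) = Linked-merge M X∈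
    where
    open Kernels M
    fibres : Fin (nV H) → Φ (nE G)
    fibres j = ∑⟨ fibre M j ⟩ X G
    v≢v' : v ≢ v'
    v≢v' v≡v' = v↮v' (≡.subst (Reach G v) v≡v' here)
    other∈ : ∀ k → k ≢ v → k ≢ v' → X G k ∈⟨ fibres ⟩
    other∈ k k≢v k≢v' = ∈⟨⟩-resp (≃-sym (fibre-isolated M (X G) k (outside⇒isolated₁ K k≢v k≢v'))) (∈⟨⟩-generator (q M k))
    Xv∈ : X G v ∈⟨ fibres ⟩
    Xv∈ = ∈⟨⟩-resp (≃-sym (∑⟨⟩-single (_≡ᵇ v) (X G) v (≡ᵇ-refl v) (λ k → ≡ᵇ⇒≡)))
            (∑⟨⟩-∈⟨⟩-complement G closed (λ k k≡ᵇv → ≡.subst (λ z → member z ≡ true) (≡.sym (≡ᵇ⇒≡ k≡ᵇv)) centre)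
              λ k in-C k≢ᵇv → other∈ k (≡ᵇ-false⇒≢ k≢ᵇv) λ { ≡.refl → v↮v' (reachable in-C) })
      where open Component (component G v)
    Xv'∈ : X G v' ∈⟨ fibres ⟩
    Xv'∈ = ∈⟨⟩-cancel (∈⟨⟩-resp (≃-trans (+Φ-comm _ _) (≃-sym (fibre-pair M (X G) v v' v≢v' (glued₁ K) (same-fibre₁ K))))
                                (∈⟨⟩-generator (q M v)))
                      Xv∈
    X∈ : ∀ i → X G i ∈⟨ fibres ⟩
    X∈ i with i ≟ v | i ≟ v'
    ... | yes ≡.refl | _          = Xv∈
    ... | no _       | yes ≡.refl = Xv'∈
    ... | no i≢v     | no i≢v'    = other∈ i i≢v i≢v'

  Linked-iso : ∀ {G H} → Iso G H → Linked G H
  Linked-iso {G} (M , q-injective) = Linked-merge M λ i →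
    ∈⟨⟩-resp (≃-sym (fibre-isolated M (X G) i λ k → q-injective k i)) (∈⟨⟩-generator (q M i))

  module SideFlip (D : Graph) (side : Fin (nV D) → Bool) (side-closed : EdgeClosed D side) where
    sideSign : Fin (nE D) → Carrier
    sideSign e = sign (side (proj₁ (ends D e)))

    flip : nE D ≅Φ nE D
    flip = relabelIso (↔-id _) sideSign (λ e → sign-square _)

    coeff-sideSign : ∀ k e → (coeff D k e * sideSign e) ≈ (sign (side k) * coeff D k e)
    coeff-sideSign k e = by-cases (k ≟ a) (k ≟ b)
      where
      a = proj₁ (ends D e)
      b = proj₂ (ends D e)
      Goal : Fin (nV D) → Set ℓ
      Goal z = (coeff D z e * sideSign e) ≈ (sign (side z) * coeff D z e)
      by-cases : Dec (k ≡ a) → Dec (k ≡ b) → Goal k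
      by-cases (yes k≡a) _         = ≡.subst Goal (≡.sym k≡a) (*-comm _ _)
      by-cases (no _)    (yes k≡b) =
        ≡.subst Goal (≡.sym k≡b) (trans (*-comm _ _) (*-cong (reflexive (≡.cong sign (side-closed e))) refl))
      by-cases (no k≢a)  (no k≢b)  = trans (*-cong vanishes refl) (trans (zeroˡ _) (sym (trans (*-cong refl vanishes) (zeroʳ _))))
        where vanishes = EdgeColumn.vanish (edgeColumn D e (inj₁ (≡.refl , ≡.refl))) k k≢a k≢b

    flip-X : ∀ k → apply (to flip) (X D k) ≃ (sign (side k) ·Φ X D k)
    flip-X k = begin
      apply (to flip) (X D k)                              ≈⟨ apply-X D (to flip) k ⟩
      sum (λ e → coeff D k e ·Φ apply (to flip) (φ e))     ≈⟨ ΦΣ.sum-cong-≋ (λ e → ·Φ-cong refl (relabel-φ id sideSign e)) ⟩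
      sum (λ e → coeff D k e ·Φ (sideSign e ·Φ φ e))
        ≈⟨ ΦΣ.sum-cong-≋ (λ e → ≃-trans (·Φ-assoc _ _ _) (·Φ-congˡ (φ e) (coeff-sideSign k e))) ⟩
      sum (λ e → (sign (side k) * coeff D k e) ·Φ φ e)     ≈⟨ ΦΣ.sum-cong-≋ (λ e → ·Φ-assoc (sign (side k)) (coeff D k e) (φ e)) ⟨
      sum (λ e → sign (side k) ·Φ (coeff D k e ·Φ φ e))    ≈⟨ ·Φ-sum (sign (side k)) (λ e → coeff D k e ·Φ φ e) ⟨
      sign (side k) ·Φ sum (λ e → coeff D k e ·Φ φ e)      ≈⟨ ·Φ-cong refl (X≃sum D k) ⟨
      sign (side k) ·Φ X D k                               ∎
      where open ≃-Reasoning

  module Twist {G H : Graph} (D : Graph) (side : Fin (nV D) → Bool) (side-closed : EdgeClosed D side)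
    {u₁ v₁ u₂ v₂ : Fin (nV D)} (side-u₁ : side u₁ ≡ true) (side-v₁ : side v₁ ≡ true)
    (side-u₂ : side u₂ ≡ false) (side-v₂ : side v₂ ≡ false) (u₁≢v₁ : u₁ ≢ v₁) (u₂≢v₂ : u₂ ≢ v₂)
    (M : Merge D G) (K : KernelIs2 M u₁ u₂ v₁ v₂) (M' : Merge D H) (K' : KernelIs2 M' u₁ v₂ u₂ v₁) where
    open SideFlip D side side-closed
    open Kernels

    Y Y' : Fin (nV D) → Φ (nE D)
    Y = X D
    Y' k = sign (side k) ·Φ Y k
    A : Fin (nV G) → Φ (nE D)
    A j = ∑⟨ fibre M j ⟩ Y
    B : Fin (nV H) → Φ (nE D)
    B j = ∑⟨ fibre M' j ⟩ Y'

    flipped : ∀ j → apply (to flip) (apply (to (mergeIso M')) (X H j)) ≃ B j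
    flipped j = ≃-trans (apply-cong (to flip) (mergeIso-X M' j))
               (≃-trans (apply-∑⟨⟩ (to flip) (fibre M' j) Y) (ΦΣ.sum-cong-≋ λ k → ·Φ-cong refl (flip-X k)))

    sides-differ : ∀ {x y} → side x ≡ true → side y ≡ false → x ≢ y
    sides-differ sx sy ≡.refl = true≢false (≡.trans (≡.sym sx) sy)

    u₁≢u₂ : u₁ ≢ u₂
    u₁≢u₂ = sides-differ side-u₁ side-u₂
    u₁≢v₂ : u₁ ≢ v₂
    u₁≢v₂ = sides-differ side-u₁ side-v₂
    v₁≢u₂ : v₁ ≢ u₂
    v₁≢u₂ = sides-differ side-v₁ side-u₂
    v₁≢v₂ : v₁ ≢ v₂
    v₁≢v₂ = sides-differ side-v₁ side-v₂

    Y'-true : ∀ {k} → side k ≡ true → Y' k ≃ Y k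
    Y'-true sk = ≃-trans (·Φ-congˡ _ (reflexive (≡.cong sign sk))) (·Φ-identity _)

    Y'-false : ∀ {k} → side k ≡ false → Y' k ≃ (-Φ Y k)
    Y'-false sk = ·Φ-congˡ _ (reflexive (≡.cong sign sk))

    Y≃±Y' : ∀ k → Y k ≃ (sign (side k) ·Φ Y' k)
    Y≃±Y' k = ≃-sym (≃-trans (·Φ-assoc _ _ _) (≃-trans (·Φ-congˡ _ (sign-square (side k))) (·Φ-identity _)))

    -- The components of u₂ and v₂ lie on the false side, so their other vertices are unmerged.
    Yu₂+Yv₂∈⟨⟩ : ∀ {n} {w : Fin n → Φ (nE D)} → (∀ k → k ≢ u₁ → k ≢ u₂ → k ≢ v₁ → k ≢ v₂ → Y k ∈⟨ w ⟩) →
         (Y u₂ +Φ Y v₂) ∈⟨ w ⟩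
    Yu₂+Yv₂∈⟨⟩ interior∈ =
      ∈⟨⟩-resp (≃-sym (∑⟨⟩-pair (pair u₂ v₂) Y u₂ v₂ u₂≢v₂ (proj₁ (pair-includes u₂ v₂)) (proj₂ (pair-includes u₂ v₂))
                                (λ k → pair-member u₂ v₂)))
               (∑⟨⟩-∈⟨⟩-complement D T-closed S⊆T rest∈)
      where
      module C = Component (component D u₂)
      module C' = Component (component D v₂)
      T : Fin (nV D) → Bool
      T k = C.member k ∨ C'.member k
      T-closed : EdgeClosed D T
      T-closed e = ≡.cong₂ _∨_ (C.closed e) (C'.closed e)
      S⊆T : ∀ k → pair u₂ v₂ k ≡ true → T k ≡ true
      S⊆T k k∈ with pair-member u₂ v₂ {k} k∈
      ... | inj₁ ≡.refl = ≡.cong (_∨ C'.member u₂) C.centre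
      ... | inj₂ ≡.refl = ≡.trans (≡.cong (C.member v₂ ∨_) C'.centre) (Bool.∨-zeroʳ _)
      false-side : ∀ k → T k ≡ true → side k ≡ false
      false-side k Tk with ∨-true Tk
      ... | inj₁ in-C  = ≡.trans (closed-constant-on-Reach side-closed (C.reachable in-C)) side-u₂
      ... | inj₂ in-C' = ≡.trans (closed-constant-on-Reach side-closed (C'.reachable in-C')) side-v₂
      rest∈ : ∀ k → T k ≡ true → pair u₂ v₂ k ≡ false → Y k ∈⟨ _ ⟩
      rest∈ k Tk k∉ = interior∈ k (sides-differ side-u₁ (false-side k Tk) ∘ ≡.sym) (proj₁ (pair-nonmember u₂ v₂ {k} k∉))
                                  (sides-differ side-v₁ (false-side k Tk) ∘ ≡.sym) (proj₂ (pair-nonmember u₂ v₂ {k} k∉))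

    twisted-u : (Y' u₁ +Φ Y' v₂) ≃ (Y u₁ +Φ (-Φ Y v₂))
    twisted-u = +Φ-cong (Y'-true side-u₁) (Y'-false side-v₂)

    twisted-v : (Y' u₂ +Φ Y' v₁) ≃ (Y v₁ +Φ (-Φ Y u₂))
    twisted-v = ≃-trans (+Φ-comm _ _) (+Φ-cong (Y'-true side-v₁) (Y'-false side-u₂))

    Y∈⟨A⟩ : ∀ k → k ≢ u₁ → k ≢ u₂ → k ≢ v₁ → k ≢ v₂ → Y k ∈⟨ A ⟩
    Y∈⟨A⟩ k k≢u₁ k≢u₂ k≢v₁ k≢v₂ =
      ∈⟨⟩-resp (≃-sym (fibre-isolated M Y k (outside⇒isolated₂ M K k≢u₁ k≢u₂ k≢v₁ k≢v₂))) (∈⟨⟩-generator (q M k))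

    Y∈⟨B⟩ : ∀ k → k ≢ u₁ → k ≢ u₂ → k ≢ v₁ → k ≢ v₂ → Y k ∈⟨ B ⟩
    Y∈⟨B⟩ k k≢u₁ k≢u₂ k≢v₁ k≢v₂ = ∈⟨⟩-resp (Y≃±Y' k) (∈⟨⟩-· _
      (∈⟨⟩-resp (≃-sym (fibre-isolated M' Y' k (outside⇒isolated₂ M' K' k≢u₁ k≢v₂ k≢u₂ k≢v₁))) (∈⟨⟩-generator (q M' k))))

    A⊆B : ∀ j → A j ∈⟨ B ⟩
    A⊆B = fibres-∈⟨⟩₂ M K u₁≢v₁ u₁≢v₂ (v₁≢u₂ ∘ ≡.sym) u₁≢u₂ v₁≢v₂ Y∈⟨B⟩ u∈ v∈
      where
      B-u : (Y' u₁ +Φ Y' v₂) ∈⟨ B ⟩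
      B-u = ∈⟨⟩-resp (≃-sym (fibre-pair M' Y' u₁ v₂ u₁≢v₂ (glued₂ M' K') (same-fibre₂ M' K' u₁≢u₂ u₁≢v₁)))
                     (∈⟨⟩-generator (q M' u₁))
      B-v : (Y' u₂ +Φ Y' v₁) ∈⟨ B ⟩
      B-v = ∈⟨⟩-resp (≃-sym (fibre-pair M' Y' u₂ v₁ (v₁≢u₂ ∘ ≡.sym) (glued₂ M' (swap₂ M' K'))
                                        (same-fibre₂ M' (swap₂ M' K') (u₁≢u₂ ∘ ≡.sym) u₂≢v₂)))
                     (∈⟨⟩-generator (q M' u₂))
      u∈ : (Y u₁ +Φ Y u₂) ∈⟨ B ⟩
      u∈ = ∈⟨⟩-resp (≃-sym (-Φ-cancel (Y u₁) (Y u₂) (Y v₂))) (∈⟨⟩-+ (∈⟨⟩-resp (≃-sym twisted-u) B-u) (Yu₂+Yv₂∈⟨⟩ Y∈⟨B⟩))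
      v∈ : (Y v₁ +Φ Y v₂) ∈⟨ B ⟩
      v∈ = ∈⟨⟩-resp (≃-sym (-Φ-cancel (Y v₁) (Y v₂) (Y u₂)))
             (∈⟨⟩-+ (∈⟨⟩-resp (≃-sym twisted-v) B-v) (∈⟨⟩-resp (+Φ-comm _ _) (Yu₂+Yv₂∈⟨⟩ Y∈⟨B⟩)))

    B⊆A : ∀ j → B j ∈⟨ A ⟩
    B⊆A = fibres-∈⟨⟩₂ M' K' u₁≢u₂ u₁≢v₁ (u₂≢v₂ ∘ ≡.sym) u₁≢v₂ (v₁≢u₂ ∘ ≡.sym)
            (λ k k≢u₁ k≢v₂ k≢u₂ k≢v₁ → ∈⟨⟩-· _ (Y∈⟨A⟩ k k≢u₁ k≢u₂ k≢v₁ k≢v₂)) u∈ v∈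
      where
      A-u : (Y u₁ +Φ Y u₂) ∈⟨ A ⟩
      A-u = ∈⟨⟩-resp (≃-sym (fibre-pair M Y u₁ u₂ u₁≢u₂ (glued₂ M K) (same-fibre₂ M K u₁≢v₁ u₁≢v₂))) (∈⟨⟩-generator (q M u₁))
      A-v : (Y v₁ +Φ Y v₂) ∈⟨ A ⟩
      A-v = ∈⟨⟩-resp (≃-sym (fibre-pair M Y v₁ v₂ v₁≢v₂ (glued₂ M (swap₂ M K)) (same-fibre₂ M (swap₂ M K) (u₁≢v₁ ∘ ≡.sym) v₁≢u₂)))
                     (∈⟨⟩-generator (q M v₁))
      u∈ : (Y' u₁ +Φ Y' v₂) ∈⟨ A ⟩
      u∈ = ∈⟨⟩-resp twisted-u (∈⟨⟩-cancel (∈⟨⟩-resp (-Φ-cancel (Y u₁) (Y u₂) (Y v₂)) A-u) (Yu₂+Yv₂∈⟨⟩ Y∈⟨A⟩))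
      v∈ : (Y' u₂ +Φ Y' v₁) ∈⟨ A ⟩
      v∈ = ∈⟨⟩-resp twisted-v (∈⟨⟩-cancel (∈⟨⟩-resp (-Φ-cancel (Y v₁) (Y v₂) (Y u₂)) A-v)
                                          (∈⟨⟩-resp (+Φ-comm _ _) (Yu₂+Yv₂∈⟨⟩ Y∈⟨A⟩)))

    linked : Linked G H
    linked = record
      { χ = mergeIso M ; χ' = ≅Φ-trans (mergeIso M') flip ; spans = SameSpan-resp (mergeIso-X M) flipped (A⊆B , B⊆A) }

  Linked-twisting : ∀ {G H} → Twisting G H → Linked G H
  Linked-twisting (D , side , side-closed , u₁ , v₁ , u₂ , v₂ ,
                   side-u₁ , side-v₁ , side-u₂ , side-v₂ , u₁≢v₁ , u₂≢v₂ , (M , K) , (M' , K')) =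
    Twist.linked D side side-closed side-u₁ side-v₁ side-u₂ side-v₂ u₁≢v₁ u₂≢v₂ M K M' K'

  Linked-step : ∀ {G H} → Step G H → Linked G H
  Linked-step (inj₁ identification)              = Linked-identification identification
  Linked-step (inj₂ (inj₁ cleaving))             = Linked-sym (Linked-identification cleaving)
  Linked-step (inj₂ (inj₂ (inj₁ twisting)))      = Linked-twisting twisting
  Linked-step (inj₂ (inj₂ (inj₂ isomorphism)))   = Linked-iso isomorphism

  obtainable⇒AlgIso : ∀ {G H} → Obtainable G H → AlgIso G H
  obtainable⇒AlgIso {G} Star.ε       = Linked⇒AlgIso (Linked-refl G)
  obtainable⇒AlgIso (s Star.◅ steps) = AlgIso-trans (Linked⇒AlgIso (Linked-step s)) (obtainable⇒AlgIso steps)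

mainTheorem2 : ∀ {c ℓ : Level} (F : Field c ℓ) → CharZero F →
    (G G' : Graph) → Obtainable G G' → Alg.AlgIso F G G'
mainTheorem2 F _ G G' = Operations.obtainable⇒AlgIso F
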